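{- Let $m,k\in\mathbb Z^+$, $a_1,\ldots,a_k\in\mathbb Z$, $n_1,\ldots,n_k\in\mathbb Z^+$, and suppose $\{a_s(n_s)\}_{s=1}^k$ is an $m$-system (i.e. every $x\in\mathbb Z$ satisfies $|\{1\leqslant s\leqslant k: x\equiv a_s\pmod{n_s}\}|\leqslant m$). Then $$\sum_{\substack{m_s\in[1,n_s]\text{ for }s\in[1,k]\\ m-\sum_{s=1}^km_s/n_s\in\mathbb N}}\binom{k-1-\sum_{s=1}^km_s/n_s}{m-\sum_{s=1}^km_s/n_s}e^{2\pi i\sum_{s=1}^ka_sm_s/n_s}=(-1)^{k-m}.$$
   Context: $\mathbb N=\{0,1,2,\ldots\}$; $[1,n_s]=\{1,\ldots,n_s\}$. For an integer $x$ (possibly negative) and $j\in\mathbb N$, $\binom{x}{j}=x(x-1)\cdots(x-j+1)/j!$ is the generalized binomial coefficient. -}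

module Defs where

open import Level using (Level)
open import Data.Nat as ℕ using (ℕ; zero; suc; _!; NonZero)
open import Data.Nat.Properties using (_!≢0)
open import Data.Nat.Divisibility as ℕD using ()
open import Data.Integer as ℤ using (ℤ; +_; -[1+_]; ∣_∣; _/ℕ_)
open import Data.Integer.Divisibility as ℤD using ()
open import Data.Vec using (Vec; []; _∷_)
open import Data.List using (List; []; _∷_; map; concatMap; upTo; foldr)
open import Data.Sum using (_⊎_)
open import Data.Empty using (⊥)
open import Relation.Nullary using (¬_; does)
open import Data.Bool using (if_then_else_)
open import Relation.Binary.PropositionalEquality using (_≡_)
open import Algebra.Bundles using (CommutativeRing)
import Algebra.Bundles

fallingℤ : ℤ → ℕ → ℤ
fallingℤ x zero    = + 1
fallingℤ x (suc j) = fallingℤ x j ℤ.* (x ℤ.- + j)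

gbinom : ℤ → ℕ → ℤ
gbinom x j = (fallingℤ x j /ℕ (j !)) {{j !≢0}}

prodℕ : ∀ {k} → Vec ℕ k → ℕ
prodℕ []       = 1
prodℕ (n ∷ ns) = n ℕ.* prodℕ ns

-- scaledSum n v = N * Σ_s v_s / n_s  (= Σ_s v_s * (N / n_s)),  N = prodℕ n,
-- computed without division:  N·(v₀/n₀ + rest) = v₀·prod ns + n₀·(prod ns · rest).
scaledSumℕ : ∀ {k} → Vec ℕ k → Vec ℕ k → ℕ
scaledSumℕ []       []       = 0
scaledSumℕ (n ∷ ns) (v ∷ vs) = v ℕ.* prodℕ ns ℕ.+ n ℕ.* scaledSumℕ ns vs

scaledSumℤ : ∀ {k} → Vec ℕ k → Vec ℤ k → ℤ
scaledSumℤ []       []       = + 0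
scaledSumℤ (n ∷ ns) (v ∷ vs) = v ℤ.* + prodℕ ns ℤ.+ + n ℤ.* scaledSumℤ ns vs

mulVec : ∀ {k} → Vec ℤ k → Vec ℕ k → Vec ℤ k
mulVec []       []       = []
mulVec (a ∷ as) (m ∷ ms) = (a ℤ.* + m) ∷ mulVec as ms

tuples : ∀ {k} → Vec ℕ k → List (Vec ℕ k)
tuples []       = [] ∷ []
tuples (n ∷ ns) = concatMap (λ i → map (i ∷_) (tuples ns)) (map suc (upTo n))

coverCount : ∀ {k} → ℤ → Vec ℤ k → Vec ℕ k → ℕ
coverCount x []       []       = 0
coverCount x (a ∷ as) (n ∷ ns) =
  (if does (n ℕD.∣? ∣ x ℤ.- a ∣) then 1 else 0) ℕ.+ coverCount x as ns

IsMSystem : ∀ {k} → ℕ → Vec ℤ k → Vec ℕ k → Set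
IsMSystem m a n = ∀ (x : ℤ) → coverCount x a n ℕ.≤ m

AllPositive : ∀ {k} → Vec ℕ k → Set
AllPositive []       = Data.Unit.⊤ where import Data.Unit
AllPositive (n ∷ ns) = (0 ℕ.< n) Data.Product.× AllPositive ns where import Data.Product

module _ {c ℓ : Level} (R : CommutativeRing c ℓ) where
  open CommutativeRing R
  open import Algebra.Definitions.RawSemiring (Algebra.Bundles.Semiring.rawSemiring semiring) using (_×_; _^_)

  record IsChar0Domain : Set (c Level.⊔ ℓ) where
    field
      noZeroDivisors : ∀ x y → x * y ≈ 0# → (x ≈ 0#) ⊎ (y ≈ 0#)
      char0          : ∀ (n : ℕ) → ¬ (suc n × 1# ≈ 0#)

  record IsPrimitiveRoot (N : ℕ) (ω : Carrier) : Set ℓ where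
    field
      root      : ω ^ N ≈ 1#
      isPrimitive : ∀ (d : ℕ) → 0 ℕ.< d → d ℕ.< N → ¬ (ω ^ d ≈ 1#)

  ιℤ : ℤ → Carrier
  ιℤ (+ n)     = n × 1#
  ιℤ -[1+ n ]  = - (suc n × 1#)

  -- ω^e for e ∈ ℤ, where ω is an N-th root of unity (ω⁻¹ = ω^(N-1))
  powℤ : ℕ → Carrier → ℤ → Carrier
  powℤ N ω (+ e)     = ω ^ e
  powℤ N ω -[1+ e ]  = (ω ^ (N ℕ.∸ 1)) ^ suc e

  ringSum : List Carrier → Carrier
  ringSum = foldr _+_ 0#

  sumUpTo : ℕ → (ℕ → Carrier) → Carrier
  sumUpTo m f = ringSum (map f (upTo (suc m)))

  -- the left-hand side, with e^{2πi t} := ω^{N t} for t ∈ (1/N)ℤ, N = n_1⋯n_k.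
  -- For each tuple ms, the index j ranges over the possible values of
  -- Σ_s m_s/n_s with m - Σ_s m_s/n_s ∈ ℕ, i.e. Σ_s m_s/n_s = j ∈ [0, m].
  corollaryLHS : ℕ → (k : ℕ) → Vec ℤ k → Vec ℕ k → Carrier → Carrier
  corollaryLHS m k a n ω =
    ringSum (map term (tuples n))
    where
      N = prodℕ n
      term : Vec ℕ k → Carrier
      term ms = sumUpTo m λ j →
        if does (j ℕ.* N ℕ.≟ scaledSumℕ n ms)
          then ιℤ (gbinom (+ k ℤ.- + 1 ℤ.- + j) (m ℕ.∸ j))
               * powℤ N ω (scaledSumℤ n (mulVec a ms))
          else 0#

  signPow : ℤ → Carrier
  signPow e = (- 1#) ^ ∣ e ∣

{-# OPTIONS --safe #-}
-- Write N = n₁⋯n_k and x(m) = N·Σ m_s/n_s ∈ [0, kN]; the left-hand side only sees tuples with x = jN, and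
-- e^{2πi Σ a_s m_s/n_s} is χ(m) = ω^{N·Σ a_s m_s/n_s} for a primitive N-th root of unity ω.
--
-- Vanishing: if G is a polynomial of degree < k − m, then  Σ_{m : N ∣ x(m)} G(x(m)) χ(m) = 0.  Indeed
-- N·[N ∣ x] = Σ_{ρ<N} ω^{ρx}, and ω^{ρx}χ is a character of ∏ ℤ/n_s that is trivial in coordinate s only
-- when −ρ ≡ a_s (mod n_s), i.e. for at most m coordinates; summing a polynomial in x against a character
-- with d nontrivial coordinates gives 0 when its degree is < d (a nontrivial coordinate contributes a
-- vanishing geometric sum after splitting off a finite difference, which lowers the degree).
--
-- If k > m, put q = k − m − 1 and G(x) = ∏_{t=1}^{q} ((m + t)N − x).  Then G(jN) = N^q q!·binom(k−1−j, m−j)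
-- for j ≤ m and G(jN) = 0 for m < j < k, so the vanishing statement leaves only the tuple m = n (the only
-- one with x = kN, where χ = 1):  N^q q!·LHS = −G(kN) = (−1)^{k−m} N^q q!.  If k ≤ m, every level j < k
-- has binom(k−1−j, m−j) = 0 and the top tuple contributes binom(−1, m−k) = (−1)^{m−k}.
-- An integral domain R of characteristic 0 stands in for ℂ; that is exactly what cancelling N and N^q q! needs.
module Submission where

open import Defs
open import Algebra.Bundles using (CommutativeRing)
import Algebra.Bundles
import Algebra.Solver.Ring
open import Algebra.Solver.Ring.AlmostCommutativeRing using (fromCommutativeRing; _-Raw-AlmostCommutative⟶_)
open import Data.Nat as ℕ using (ℕ; zero; suc; _!)
import Data.Nat.Properties as ℕP
open import Data.Nat.Divisibility as ℕD using (_∣_; _∣?_; divides)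
import Data.Nat.Combinatorics as ℕC
open import Data.Nat.Combinatorics.Base using (_P′_)
import Data.Nat.DivMod as ℕDM
open import Data.Integer as ℤ using (ℤ; +_; -[1+_]; -1ℤ; 1ℤ; _⊖_)
import Data.Integer.Properties as ℤP
import Data.Integer.DivMod as ℤDM
import Data.Integer.Divisibility.Signed as ℤS
open import Data.Nat.Tactic.RingSolver using (solve-∀)
open import Data.Integer.Tactic.RingSolver using () renaming (solve-∀ to solveℤ-∀)
open import Data.Bool.Properties using (T-≡)
open import Data.Sum using (_⊎_; inj₁; inj₂)
open import Data.Product using (_,_; proj₁; proj₂) renaming (_×_ to _×′_)
open import Data.Maybe using (Maybe; just; nothing)
open import Data.List using (List; []; _∷_; map; upTo; concatMap; _++_)
import Data.List.Properties as ListP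
open import Data.Vec.Relation.Binary.Pointwise.Inductive using (Pointwise; []; _∷_)
open import Data.Vec.Relation.Unary.All as AllV using (All; []; _∷_)
open import Data.Vec as Vec using (Vec; []; _∷_)
open import Function.Bundles using (Equivalence)
open import Relation.Binary.PropositionalEquality as ≡ using (_≡_; cong; cong₂)
open import Relation.Nullary using (Dec; yes; no; ¬_; does; contradiction)
open import Relation.Nullary.Decidable using (dec-true; dec-false)
open import Data.Bool using (true; false; if_then_else_)

-- Generalised binomial coefficients

nPk≡nP′k : ∀ {n k} → k ℕ.≤ n → n ℕC.P k ≡ n P′ k
nPk≡nP′k {n} {k} k≤n =
  cong (λ b → if b then n P′ k else 0) (Equivalence.to T-≡ (ℕP.≤⇒≤ᵇ k≤n))

+m-+n≡+[m∸n] : ∀ {m n} → n ℕ.≤ m → + m ℤ.- + n ≡ + (m ℕ.∸ n)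
+m-+n≡+[m∸n] {m} {n} n≤m = ≡.trans (ℤP.m-n≡m⊖n m n) (ℤP.⊖-≥ n≤m)

fallingℤ-pos : ∀ {x j} → j ℕ.≤ x → fallingℤ (+ x) j ≡ + (x P′ j)
fallingℤ-pos {j = zero}      _   = ≡.refl
fallingℤ-pos {x} {suc j} j<x = begin
  fallingℤ (+ x) j ℤ.* (+ x ℤ.- + j) ≡⟨ cong₂ ℤ._*_ (fallingℤ-pos (ℕP.<⇒≤ j<x)) (+m-+n≡+[m∸n] (ℕP.<⇒≤ j<x)) ⟩
  + (x P′ j) ℤ.* + (x ℕ.∸ j)         ≡⟨ ℤP.pos-* (x P′ j) (x ℕ.∸ j) ⟨
  + ((x P′ j) ℕ.* (x ℕ.∸ j))        ≡⟨ cong +_ (ℕP.*-comm (x P′ j) (x ℕ.∸ j)) ⟩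
  + ((x ℕ.∸ j) ℕ.* (x P′ j))        ∎
  where open ≡.≡-Reasoning

fallingℤ-pos-vanish : ∀ {x j} → x ℕ.< j → fallingℤ (+ x) j ≡ + 0
fallingℤ-pos-vanish {x} {suc j} x<1+j with ℕP.m≤n⇒m<n∨m≡n (ℕP.≤-pred x<1+j)
... | inj₁ x<j  = cong (ℤ._* (+ x ℤ.- + j)) (fallingℤ-pos-vanish x<j)
... | inj₂ ≡.refl = ≡.trans (cong (fallingℤ (+ x) x ℤ.*_) (ℤP.+-inverseʳ (+ x))) (ℤP.*-zeroʳ (fallingℤ (+ x) x))

gbinom-pos : ∀ x j → gbinom (+ x) j ≡ + (x ℕC.C j)
gbinom-pos x j with j ℕ.≤? x
... | yes j≤x = begin
  fallingℤ (+ x) j ℤ./ℕ j !  ≡⟨ cong (ℤ._/ℕ j !) (fallingℤ-pos j≤x) ⟩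
  + ((x P′ j) ℕ./ j !)       ≡⟨ cong (λ z → + (z ℕ./ j !)) (nPk≡nP′k j≤x) ⟨
  + ((x ℕC.P j) ℕ./ j !)     ≡⟨ cong +_ (ℕC.nCk≡nPk/k! j≤x) ⟨
  + (x ℕC.C j)               ∎
  where open ≡.≡-Reasoning; instance _ = j ℕP.!≢0
... | no j≰x = begin
  fallingℤ (+ x) j ℤ./ℕ j !  ≡⟨ cong (ℤ._/ℕ j !) (fallingℤ-pos-vanish (ℕP.≰⇒> j≰x)) ⟩
  + (0 ℕ./ j !)              ≡⟨ cong +_ (ℕDM.0/n≡0 (j !)) ⟩
  + 0                        ≡⟨ cong +_ (ℕC.k>n⇒nCk≡0 (ℕP.≰⇒> j≰x)) ⟨
  + (x ℕC.C j)               ∎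
  where open ≡.≡-Reasoning; instance _ = j ℕP.!≢0

rising : ℕ → ℕ → ℕ
rising y zero    = 1
rising y (suc q) = rising y q ℕ.* (y ℕ.+ suc q)

rising*! : ∀ y q → rising y q ℕ.* y ! ≡ (y ℕ.+ q) !
rising*! y zero    = ≡.trans (ℕP.+-identityʳ (y !)) (cong _! (≡.sym (ℕP.+-identityʳ y)))
rising*! y (suc q) = begin
  rising y q ℕ.* (y ℕ.+ suc q) ℕ.* y !    ≡⟨ rearrange (rising y q) (y ℕ.+ suc q) (y !) ⟩
  (y ℕ.+ suc q) ℕ.* (rising y q ℕ.* y !)  ≡⟨ cong₂ ℕ._*_ (ℕP.+-suc y q) (rising*! y q) ⟩
  suc (y ℕ.+ q) !                         ≡⟨ cong _! (ℕP.+-suc y q) ⟨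
  (y ℕ.+ suc q) !                         ∎
  where
  open ≡.≡-Reasoning
  rearrange : ∀ r s f → r ℕ.* s ℕ.* f ≡ s ℕ.* (r ℕ.* f)
  rearrange = solve-∀

[y+q]Cy*y!*q!≡[y+q]! : ∀ y q → ((y ℕ.+ q) ℕC.C y) ℕ.* (y ! ℕ.* q !) ≡ (y ℕ.+ q) !
[y+q]Cy*y!*q!≡[y+q]! y q = begin
  (x ℕC.C y) ℕ.* (y ! ℕ.* q !)                           ≡⟨ cong (λ t → (x ℕC.C y) ℕ.* (y ! ℕ.* t !)) (ℕP.m+n∸m≡n y q) ⟨
  (x ℕC.C y) ℕ.* (y ! ℕ.* (x ℕ.∸ y) !)                   ≡⟨ cong (ℕ._* (y ! ℕ.* (x ℕ.∸ y) !)) (ℕC.nCk≡n!/k![n-k]! y≤x) ⟩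
  x ! ℕ./ (y ! ℕ.* (x ℕ.∸ y) !) ℕ.* (y ! ℕ.* (x ℕ.∸ y) !) ≡⟨ ℕDM.m/n*n≡m (ℕC.k![n∸k]!∣n! y≤x) ⟩
  x !                                                     ∎
  where
  open ≡.≡-Reasoning
  x = y ℕ.+ q
  y≤x = ℕP.m≤m+n y q
  instance _ = y ℕP.!* (x ℕ.∸ y) !≢0

q!*[y+q]Cy≡rising : ∀ y q → q ! ℕ.* ((y ℕ.+ q) ℕC.C y) ≡ rising y q
q!*[y+q]Cy≡rising y q = ℕP.*-cancelʳ-≡ _ _ (y !) (begin
  q ! ℕ.* ((y ℕ.+ q) ℕC.C y) ℕ.* y !    ≡⟨ rearrange (q !) ((y ℕ.+ q) ℕC.C y) (y !) ⟩
  ((y ℕ.+ q) ℕC.C y) ℕ.* (y ! ℕ.* q !)  ≡⟨ [y+q]Cy*y!*q!≡[y+q]! y q ⟩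
  (y ℕ.+ q) !                           ≡⟨ rising*! y q ⟨
  rising y q ℕ.* y !                    ∎)
  where
  open ≡.≡-Reasoning
  instance _ = y ℕP.!≢0
  rearrange : ∀ a b c → a ℕ.* b ℕ.* c ≡ b ℕ.* (c ℕ.* a)
  rearrange = solve-∀

fallingℤ-[-1] : ∀ e → fallingℤ -1ℤ e ≡ -1ℤ ℤ.^ e ℤ.* + (e !)
fallingℤ-[-1] zero    = ≡.refl
fallingℤ-[-1] (suc e) = begin
  fallingℤ -1ℤ e ℤ.* (-1ℤ ℤ.- + e)                 ≡⟨ cong (ℤ._* (-1ℤ ℤ.- + e)) (fallingℤ-[-1] e) ⟩
  -1ℤ ℤ.^ e ℤ.* + (e !) ℤ.* (-1ℤ ℤ.- + e)          ≡⟨ rearrange (-1ℤ ℤ.^ e) (+ (e !)) (+ e) ⟩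
  -1ℤ ℤ.* -1ℤ ℤ.^ e ℤ.* ((1ℤ ℤ.+ + e) ℤ.* + (e !)) ≡⟨ cong (-1ℤ ℤ.* -1ℤ ℤ.^ e ℤ.*_) (ℤP.pos-* (suc e) (e !)) ⟨
  -1ℤ ℤ.* -1ℤ ℤ.^ e ℤ.* + (suc e !)                ∎
  where
  open ≡.≡-Reasoning
  rearrange : ∀ s f e → s ℤ.* f ℤ.* (ℤ.- 1ℤ ℤ.- e) ≡ ℤ.- 1ℤ ℤ.* s ℤ.* ((1ℤ ℤ.+ e) ℤ.* f)
  rearrange = solveℤ-∀

-1ℤ^e≡±1 : ∀ e → -1ℤ ℤ.^ e ≡ 1ℤ ⊎ -1ℤ ℤ.^ e ≡ -1ℤ
-1ℤ^e≡±1 zero = inj₁ ≡.refl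
-1ℤ^e≡±1 (suc e) with -1ℤ^e≡±1 e
... | inj₁ eq = inj₂ (cong (-1ℤ ℤ.*_) eq)
... | inj₂ eq = inj₁ (cong (-1ℤ ℤ.*_) eq)

-[1+d]/ℕ[1+d]≡-1 : ∀ d → -[1+ d ] ℤ./ℕ suc d ≡ -1ℤ
-[1+d]/ℕ[1+d]≡-1 d with suc d ℕ.% suc d in eq
... | zero  = cong (λ t → ℤ.- + t) (ℕDM.n/n≡1 (suc d))
... | suc _ with () ← ≡.trans (≡.sym eq) (ℕDM.n%n≡0 (suc d))

±1*d/ℕd≡±1 : ∀ {s} d .{{_ : ℕ.NonZero d}} → s ≡ 1ℤ ⊎ s ≡ -1ℤ → (s ℤ.* + d) ℤ./ℕ d ≡ s
±1*d/ℕd≡±1 d       (inj₁ ≡.refl) = ≡.trans (cong (ℤ._/ℕ d) (ℤP.*-identityˡ (+ d))) (cong +_ (ℕDM.n/n≡1 d))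
±1*d/ℕd≡±1 (suc d) (inj₂ ≡.refl) = ≡.trans (cong (ℤ._/ℕ suc d) (ℤP.-1*i≡-i (+ suc d))) (-[1+d]/ℕ[1+d]≡-1 d)

gbinom-[-1] : ∀ e → gbinom -1ℤ e ≡ -1ℤ ℤ.^ e
gbinom-[-1] e = ≡.trans (cong (ℤ._/ℕ e !) (fallingℤ-[-1] e)) (±1*d/ℕd≡±1 (e !) (-1ℤ^e≡±1 e))
  where instance _ = e ℕP.!≢0

+k-+1-+j≡+[k∸1∸j] : ∀ {k j} → j ℕ.< k → + k ℤ.- + 1 ℤ.- + j ≡ + (k ℕ.∸ 1 ℕ.∸ j)
+k-+1-+j≡+[k∸1∸j] {suc k} {j} (ℕ.s≤s j≤k) = ≡.trans (cong (ℤ._- + j) (+m-+n≡+[m∸n] (ℕ.s≤s ℕ.z≤n))) (+m-+n≡+[m∸n] j≤k)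

+k-+1-+k≡-1 : ∀ k → + k ℤ.- + 1 ℤ.- + k ≡ -1ℤ
+k-+1-+k≡-1 k = cancel (+ k)
  where
  cancel : ∀ k → k ℤ.- 1ℤ ℤ.- k ≡ ℤ.- 1ℤ
  cancel = solveℤ-∀

-- Scaled sums  N·Σ c_s m_s / n_s

prodℕ-pos : ∀ {k} (n : Vec ℕ k) → AllPositive n → 0 ℕ.< prodℕ n
prodℕ-pos []       _            = ℕ.s≤s ℕ.z≤n
prodℕ-pos (n ∷ ns) (n>0 , ns>0) = ℕP.*-mono-< n>0 (prodℕ-pos ns ns>0)

scaledSumℕ≤k*prodℕ : ∀ {k} (n ms : Vec ℕ k) → Pointwise ℕ._≤_ ms n → scaledSumℕ n ms ℕ.≤ k ℕ.* prodℕ n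
scaledSumℕ≤k*prodℕ []       []       []           = ℕ.z≤n
scaledSumℕ≤k*prodℕ {suc k} (n ∷ ns) (v ∷ vs) (v≤n ∷ vs≤ns) = begin
  v ℕ.* P ℕ.+ n ℕ.* scaledSumℕ ns vs ≤⟨ ℕP.+-mono-≤ (ℕP.*-monoˡ-≤ P v≤n) (ℕP.*-monoʳ-≤ n (scaledSumℕ≤k*prodℕ ns vs vs≤ns)) ⟩
  n ℕ.* P ℕ.+ n ℕ.* (k ℕ.* P)         ≡⟨ expand n P k ⟨
  suc k ℕ.* (n ℕ.* P)                ∎
  where
  open ℕP.≤-Reasoning
  P = prodℕ ns
  expand : ∀ n P k → suc k ℕ.* (n ℕ.* P) ≡ n ℕ.* P ℕ.+ n ℕ.* (k ℕ.* P)
  expand = solve-∀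

-- One induction step of: N·Σ m_s/n_s attains its maximum kN only at m = n.
scaledSumℕ-∷≡max : ∀ {v n S K P} → v ℕ.≤ n → S ℕ.≤ K → 0 ℕ.< P → 0 ℕ.< n →
                   v ℕ.* P ℕ.+ n ℕ.* S ≡ n ℕ.* P ℕ.+ n ℕ.* K → v ≡ n ×′ S ≡ K
scaledSumℕ-∷≡max {v} {n} {S} {K} {P} v≤n S≤K P>0 n>0 eq with ℕP.m≤n⇒m<n∨m≡n v≤n
... | inj₁ v<n  = contradiction eq (ℕP.<⇒≢ (ℕP.+-mono-<-≤ (ℕP.*-monoˡ-< P {{ℕ.>-nonZero P>0}} {v} {n} v<n) (ℕP.*-monoʳ-≤ n S≤K)))
... | inj₂ ≡.refl = ≡.refl , ℕP.*-cancelˡ-≡ S K n {{ℕ.>-nonZero n>0}} (ℕP.+-cancelˡ-≡ (v ℕ.* P) _ _ eq)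

scaledDot : ∀ {k} → Vec ℕ k → Vec ℕ k → Vec ℕ k → ℕ
scaledDot n c ms = scaledSumℕ n (Vec.zipWith ℕ._*_ c ms)

scaledDot-shift : ∀ {a} {A : Set a} {k} (f : A → ℕ) ρ (n : Vec ℕ k) (x : Vec A k) ms →
  scaledDot n (Vec.map (λ z → ρ ℕ.+ f z) x) ms ≡ scaledSumℕ n ms ℕ.* ρ ℕ.+ scaledDot n (Vec.map f x) ms
scaledDot-shift f ρ []       []       []       = ≡.refl
scaledDot-shift f ρ (n ∷ ns) (x ∷ xs) (v ∷ vs) =
  ≡.trans (cong (λ t → (ρ ℕ.+ f x) ℕ.* v ℕ.* prodℕ ns ℕ.+ n ℕ.* t) (scaledDot-shift f ρ ns xs vs))
          (rearrange ρ (f x) v (prodℕ ns) n (scaledSumℕ ns vs) (scaledDot ns (Vec.map f xs) vs))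
  where
  rearrange : ∀ ρ c v P n S X → (ρ ℕ.+ c) ℕ.* v ℕ.* P ℕ.+ n ℕ.* (S ℕ.* ρ ℕ.+ X)
                                ≡ (v ℕ.* P ℕ.+ n ℕ.* S) ℕ.* ρ ℕ.+ (c ℕ.* v ℕ.* P ℕ.+ n ℕ.* X)
  rearrange = solve-∀

scaledDot-top : ∀ {k} (n c : Vec ℕ k) → scaledDot n c n ≡ Vec.sum c ℕ.* prodℕ n
scaledDot-top []       []       = ≡.refl
scaledDot-top (n ∷ ns) (c ∷ cs) =
  ≡.trans (cong (λ t → c ℕ.* n ℕ.* prodℕ ns ℕ.+ n ℕ.* t) (scaledDot-top ns cs)) (rearrange c n (prodℕ ns) (Vec.sum cs))
  where
  rearrange : ∀ c n P S → c ℕ.* n ℕ.* P ℕ.+ n ℕ.* (S ℕ.* P) ≡ (c ℕ.+ S) ℕ.* (n ℕ.* P)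
  rearrange = solve-∀

+[u+q*N]≡+u++q*+N : ∀ u q N → + (u ℕ.+ q ℕ.* N) ≡ + u ℤ.+ + q ℤ.* + N
+[u+q*N]≡+u++q*+N u q N = ≡.trans (ℤP.pos-+ u (q ℕ.* N)) (cong (ℤ._+_ (+ u)) (ℤP.pos-* q N))

-- powℤ reads ω^{−(e+1)} as (ω^{N−1})^{e+1}, which is right because (N − 1)(e + 1) ≡ −(e + 1) (mod N).
N′[1+e]≡-[1+e]-mod : ∀ {u Y} N′ e → -[1+ e ] ≡ + u ℤ.+ Y ℤ.* + suc N′ → + (N′ ℕ.* suc e) ≡ + u ℤ.+ (Y ℤ.+ + suc e) ℤ.* + suc N′
N′[1+e]≡-[1+e]-mod {u} {Y} N′ e eq = begin
  + (N′ ℕ.* suc e)                                ≡⟨ ℤP.pos-* N′ (suc e) ⟩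
  + N′ ℤ.* + suc e                                ≡⟨ rearrange (+ N′) (+ suc e) ⟩
  ℤ.- + suc e ℤ.+ + suc e ℤ.* (1ℤ ℤ.+ + N′)        ≡⟨ cong (ℤ._+ + suc e ℤ.* + suc N′) eq ⟩
  + u ℤ.+ Y ℤ.* + suc N′ ℤ.+ + suc e ℤ.* + suc N′  ≡⟨ regroup (+ u) Y (+ suc e) (+ suc N′) ⟩
  + u ℤ.+ (Y ℤ.+ + suc e) ℤ.* + suc N′             ∎
  where
  open ≡.≡-Reasoning
  rearrange : ∀ n s → n ℤ.* s ≡ ℤ.- s ℤ.+ s ℤ.* (1ℤ ℤ.+ n)
  rearrange = solveℤ-∀
  regroup : ∀ u Y s N → u ℤ.+ Y ℤ.* N ℤ.+ s ℤ.* N ≡ u ℤ.+ (Y ℤ.+ s) ℤ.* N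
  regroup = solveℤ-∀

scaledSumℤ-mod : ∀ {k} N .{{_ : ℕ.NonZero N}} (n : Vec ℕ k) (a : Vec ℤ k) ms →
  scaledSumℤ n (mulVec a ms) ≡ + scaledDot n (Vec.map (ℤ._%ℕ N) a) ms ℤ.+ scaledSumℤ n (mulVec (Vec.map (ℤ._/ℕ N) a) ms) ℤ.* + N
scaledSumℤ-mod N []       []       []       = ≡.refl
scaledSumℤ-mod N (n ∷ ns) (a ∷ as) (v ∷ vs) = begin
  a ℤ.* + v ℤ.* + P ℤ.+ + n ℤ.* scaledSumℤ ns (mulVec as vs)
    ≡⟨ cong₂ (λ s t → s ℤ.* + v ℤ.* + P ℤ.+ + n ℤ.* t) (ℤDM.a≡a%ℕn+[a/ℕn]*n a N) (scaledSumℤ-mod N ns as vs) ⟩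
  (+ r ℤ.+ q ℤ.* + N) ℤ.* + v ℤ.* + P ℤ.+ + n ℤ.* (+ X ℤ.+ Y ℤ.* + N)
    ≡⟨ rearrange (+ r) q (+ N) (+ v) (+ P) (+ n) (+ X) Y ⟩
  (+ r ℤ.* + v ℤ.* + P ℤ.+ + n ℤ.* + X) ℤ.+ (q ℤ.* + v ℤ.* + P ℤ.+ + n ℤ.* Y) ℤ.* + N
    ≡⟨ cong (ℤ._+ (q ℤ.* + v ℤ.* + P ℤ.+ + n ℤ.* Y) ℤ.* + N) (ℤ-homomorphic r v P n X) ⟨
  + (r ℕ.* v ℕ.* P ℕ.+ n ℕ.* X) ℤ.+ (q ℤ.* + v ℤ.* + P ℤ.+ + n ℤ.* Y) ℤ.* + N ∎
  where
  open ≡.≡-Reasoning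
  P = prodℕ ns
  r = a ℤ.%ℕ N
  q = a ℤ./ℕ N
  X = scaledDot ns (Vec.map (ℤ._%ℕ N) as) vs
  Y = scaledSumℤ ns (mulVec (Vec.map (ℤ._/ℕ N) as) vs)
  rearrange : ∀ r q N v P n X Y → (r ℤ.+ q ℤ.* N) ℤ.* v ℤ.* P ℤ.+ n ℤ.* (X ℤ.+ Y ℤ.* N)
                                  ≡ (r ℤ.* v ℤ.* P ℤ.+ n ℤ.* X) ℤ.+ (q ℤ.* v ℤ.* P ℤ.+ n ℤ.* Y) ℤ.* N
  rearrange = solveℤ-∀
  ℤ-homomorphic : ∀ r v P n X → + (r ℕ.* v ℕ.* P ℕ.+ n ℕ.* X) ≡ + r ℤ.* + v ℤ.* + P ℤ.+ + n ℤ.* + X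
  ℤ-homomorphic r v P n X = ≡.trans (ℤP.pos-+ (r ℕ.* v ℕ.* P) (n ℕ.* X))
    (cong₂ ℤ._+_ (≡.trans (ℤP.pos-* (r ℕ.* v) P) (cong (ℤ._* + P) (ℤP.pos-* r v))) (ℤP.pos-* n X))

-- Covering by residue classes

nondivisible : ∀ {k} → Vec ℕ k → Vec ℕ k → ℕ
nondivisible []       []       = 0
nondivisible (n ∷ ns) (c ∷ cs) = (if does (n ∣? c) then 0 else 1) ℕ.+ nondivisible ns cs

∣prodℕ : ∀ {k} (n : Vec ℕ k) → All (_∣ prodℕ n) n
∣prodℕ []       = []
∣prodℕ (n ∷ ns) = ℕD.m∣m*n (prodℕ ns) ∷ AllV.map (λ d∣P → ℕD.∣-trans d∣P (ℕD.n∣m*n n)) (∣prodℕ ns)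

∣-ρ-a : ∀ {n N} .{{_ : ℕ.NonZero N}} ρ a → n ∣ N → n ∣ ρ ℕ.+ a ℤ.%ℕ N → n ∣ ℤ.∣ ℤ.- + ρ ℤ.- a ∣
∣-ρ-a {n} {N} ρ a n∣N n∣ρ+r = ℤS.∣⇒∣ᵤ (≡.subst (+ n ℤS.∣_) (≡.sym -ρ-a≡) (ℤS.∣m⇒∣-m (ℤS.∣m∣n⇒∣m+n n∣ρ+r′ n∣[a/N]N)))
  where
  n∣ρ+r′ : + n ℤS.∣ + (ρ ℕ.+ a ℤ.%ℕ N)
  n∣ρ+r′ = ℤS.∣ᵤ⇒∣ n∣ρ+r
  n∣[a/N]N : + n ℤS.∣ a ℤ./ℕ N ℤ.* + N
  n∣[a/N]N = ℤS.∣n⇒∣m*n (a ℤ./ℕ N) (ℤS.∣ᵤ⇒∣ {+ n} {+ N} n∣N)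
  -ρ-a≡ : ℤ.- + ρ ℤ.- a ≡ ℤ.- (+ (ρ ℕ.+ a ℤ.%ℕ N) ℤ.+ a ℤ./ℕ N ℤ.* + N)
  -ρ-a≡ = begin
    ℤ.- + ρ ℤ.- a                                           ≡⟨ cong (λ t → ℤ.- + ρ ℤ.- t) (ℤDM.a≡a%ℕn+[a/ℕn]*n a N) ⟩
    ℤ.- + ρ ℤ.- (+ (a ℤ.%ℕ N) ℤ.+ a ℤ./ℕ N ℤ.* + N)          ≡⟨ rearrange (+ ρ) (+ (a ℤ.%ℕ N)) (a ℤ./ℕ N ℤ.* + N) ⟩
    ℤ.- (+ ρ ℤ.+ + (a ℤ.%ℕ N) ℤ.+ a ℤ./ℕ N ℤ.* + N)          ≡⟨ cong (λ t → ℤ.- (t ℤ.+ a ℤ./ℕ N ℤ.* + N)) (ℤP.pos-+ ρ (a ℤ.%ℕ N)) ⟨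
    ℤ.- (+ (ρ ℕ.+ a ℤ.%ℕ N) ℤ.+ a ℤ./ℕ N ℤ.* + N)            ∎
    where
    open ≡.≡-Reasoning
    rearrange : ∀ ρ r t → ℤ.- ρ ℤ.- (r ℤ.+ t) ≡ ℤ.- (ρ ℤ.+ r ℤ.+ t)
    rearrange = solveℤ-∀

-- Each s with n_s ∣ ρ + (a_s mod N) is a residue class of the system containing −ρ.
k≤nondivisible+coverCount : ∀ {k} N .{{_ : ℕ.NonZero N}} ρ (n : Vec ℕ k) (a : Vec ℤ k) → All (_∣ N) n →
  k ℕ.≤ nondivisible n (Vec.map (λ z → ρ ℕ.+ z ℤ.%ℕ N) a) ℕ.+ coverCount (ℤ.- + ρ) a n
k≤nondivisible+coverCount N ρ []       []       []            = ℕ.z≤n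
k≤nondivisible+coverCount N ρ (n ∷ ns) (a ∷ as) (n∣N ∷ ns∣N) with n ∣? ρ ℕ.+ a ℤ.%ℕ N
... | yes n∣ρ+r = ℕP.≤-trans (ℕ.s≤s IH) (ℕP.≤-reflexive (≡.trans (≡.sym (ℕP.+-suc nd cc))
                    (cong (λ b → nd ℕ.+ ((if b then 1 else 0) ℕ.+ cc)) (≡.sym (dec-true (n ∣? _) (∣-ρ-a ρ a n∣N n∣ρ+r))))))
  where
  nd = nondivisible ns (Vec.map (λ z → ρ ℕ.+ z ℤ.%ℕ N) as)
  cc = coverCount (ℤ.- + ρ) as ns
  IH = k≤nondivisible+coverCount N ρ ns as ns∣N
... | no _ = ℕ.s≤s (ℕP.≤-trans IH (ℕP.+-monoʳ-≤ nd (ℕP.m≤n+m cc _)))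
  where
  nd = nondivisible ns (Vec.map (λ z → ρ ℕ.+ z ℤ.%ℕ N) as)
  cc = coverCount (ℤ.- + ρ) as ns
  IH = k≤nondivisible+coverCount N ρ ns as ns∣N

module _ {c ℓ} (R : CommutativeRing c ℓ) where
  open CommutativeRing R
  open import Algebra.Definitions.RawSemiring (Algebra.Bundles.Semiring.rawSemiring semiring) using (_×_; _^_)
  open import Algebra.Properties.Semiring.Mult semiring using (×-homo-+; ×1-homo-*)
  open import Algebra.Properties.Semiring.Exp semiring using (^-congˡ; ^-congʳ; ^-homo-*; ^-assocʳ)
  open import Algebra.Properties.Ring ring using (-0#≈0#; -‿involutive; -‿+-comm; -‿distribˡ-*; -‿distribʳ-*; x∙y⁻¹≈ε⇒x≈y)
  open import Relation.Binary.Reasoning.Setoid setoid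

  -- The integers in a ring

  ιℕ : ℕ → Carrier
  ιℕ n = ιℤ R (+ n)

  ιℤ-neg : ∀ z → ιℤ R (ℤ.- z) ≈ - ιℤ R z
  ιℤ-neg (+ zero)  = sym -0#≈0#
  ιℤ-neg (+ suc n) = refl
  ιℤ-neg -[1+ n ]  = sym (-‿involutive _)

  ιℤ-⊖ : ∀ m n → ιℤ R (m ⊖ n) ≈ ιℕ m - ιℕ n
  ιℤ-⊖ m n with ℕP.≤-total n m
  ... | inj₁ n≤m = begin
    ιℤ R (m ⊖ n)                   ≡⟨ cong (ιℤ R) (ℤP.⊖-≥ n≤m) ⟩
    ιℕ (m ℕ.∸ n)                   ≈⟨ x≈[x+y]-y (ιℕ (m ℕ.∸ n)) (ιℕ n) ⟩
    (ιℕ (m ℕ.∸ n) + ιℕ n) - ιℕ n   ≈⟨ +-congʳ (×-homo-+ 1# (m ℕ.∸ n) n) ⟨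
    ιℕ (m ℕ.∸ n ℕ.+ n) - ιℕ n      ≡⟨ cong (λ t → ιℕ t - ιℕ n) (ℕP.m∸n+n≡m n≤m) ⟩
    ιℕ m - ιℕ n                    ∎
    where
    x≈[x+y]-y : ∀ x y → x ≈ (x + y) - y
    x≈[x+y]-y x y = sym (trans (+-assoc x y (- y)) (trans (+-congˡ (-‿inverseʳ y)) (+-identityʳ x)))
  ... | inj₂ m≤n = begin
    ιℤ R (m ⊖ n)                   ≡⟨ cong (ιℤ R) (ℤP.⊖-≤ m≤n) ⟩
    ιℤ R (ℤ.- + (n ℕ.∸ m))         ≈⟨ ιℤ-neg (+ (n ℕ.∸ m)) ⟩
    - ιℕ (n ℕ.∸ m)                 ≈⟨ -y≈x-[x+y] (ιℕ m) (ιℕ (n ℕ.∸ m)) ⟩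
    ιℕ m - (ιℕ m + ιℕ (n ℕ.∸ m))   ≈⟨ +-congˡ (-‿cong (×-homo-+ 1# m (n ℕ.∸ m))) ⟨
    ιℕ m - ιℕ (m ℕ.+ (n ℕ.∸ m))    ≡⟨ cong (λ t → ιℕ m - ιℕ t) (ℕP.m+[n∸m]≡n m≤n) ⟩
    ιℕ m - ιℕ n                    ∎
    where
    -y≈x-[x+y] : ∀ x y → - y ≈ x - (x + y)
    -y≈x-[x+y] x y = begin
      - y                ≈⟨ +-identityˡ (- y) ⟨
      0# - y             ≈⟨ +-congʳ (-‿inverseʳ x) ⟨
      (x - x) - y        ≈⟨ +-assoc x (- x) (- y) ⟩
      x + (- x - y)      ≈⟨ +-congˡ (-‿+-comm x y) ⟩
      x - (x + y)        ∎

  ιℤ-+ : ∀ i j → ιℤ R (i ℤ.+ j) ≈ ιℤ R i + ιℤ R j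
  ιℤ-+ (+ m)    (+ n)    = ×-homo-+ 1# m n
  ιℤ-+ (+ m)    -[1+ n ] = ιℤ-⊖ m (suc n)
  ιℤ-+ -[1+ m ] (+ n)    = trans (ιℤ-⊖ n (suc m)) (+-comm _ _)
  ιℤ-+ -[1+ m ] -[1+ n ] = begin
    - ιℕ (suc (suc (m ℕ.+ n)))     ≡⟨ cong (λ t → - ιℕ (suc t)) (ℕP.+-suc m n) ⟨
    - ιℕ (suc m ℕ.+ suc n)         ≈⟨ -‿cong (×-homo-+ 1# (suc m) (suc n)) ⟩
    - (ιℕ (suc m) + ιℕ (suc n))    ≈⟨ -‿+-comm _ _ ⟨
    - ιℕ (suc m) + - ιℕ (suc n)    ∎

  ιℤ-+* : ∀ m j → ιℤ R (+ m ℤ.* j) ≈ ιℕ m * ιℤ R j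
  ιℤ-+* zero    j = sym (zeroˡ (ιℤ R j))
  ιℤ-+* (suc m) j = begin
    ιℤ R (+ suc m ℤ.* j)               ≡⟨ cong (ιℤ R) (ℤP.suc-* (+ m) j) ⟩
    ιℤ R (j ℤ.+ + m ℤ.* j)             ≈⟨ ιℤ-+ j (+ m ℤ.* j) ⟩
    ιℤ R j + ιℤ R (+ m ℤ.* j)          ≈⟨ +-cong (sym (*-identityˡ (ιℤ R j))) (ιℤ-+* m j) ⟩
    1# * ιℤ R j + ιℕ m * ιℤ R j        ≈⟨ distribʳ (ιℤ R j) 1# (ιℕ m) ⟨
    ιℕ (suc m) * ιℤ R j                ∎

  ιℤ-* : ∀ i j → ιℤ R (i ℤ.* j) ≈ ιℤ R i * ιℤ R j
  ιℤ-* (+ m)    j = ιℤ-+* m j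
  ιℤ-* -[1+ m ] j = begin
    ιℤ R (-[1+ m ] ℤ.* j)               ≡⟨ cong (ιℤ R) (ℤP.neg-distribˡ-* (+ suc m) j) ⟨
    ιℤ R (ℤ.- (+ suc m ℤ.* j))          ≈⟨ ιℤ-neg (+ suc m ℤ.* j) ⟩
    - ιℤ R (+ suc m ℤ.* j)              ≈⟨ -‿cong (ιℤ-+* (suc m) j) ⟩
    - (ιℕ (suc m) * ιℤ R j)             ≈⟨ -‿distribˡ-* (ιℕ (suc m)) (ιℤ R j) ⟩
    - ιℕ (suc m) * ιℤ R j               ∎

  ιℤ-[-1]^ : ∀ e → ιℤ R (-1ℤ ℤ.^ e) ≈ (- 1#) ^ e
  ιℤ-[-1]^ zero    = +-identityʳ 1#
  ιℤ-[-1]^ (suc e) = trans (ιℤ-* -1ℤ (-1ℤ ℤ.^ e)) (*-cong (-‿cong (+-identityʳ 1#)) (ιℤ-[-1]^ e))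

  -- The solver's coefficient map: ιℤ, except that 1ℤ goes to 1# on the nose (ιℤ R 1ℤ is 1# + 0#),
  -- so that the constant  con 1ℤ  in a solved equation is literally 1#.
  private
    ⟦_⟧ᶜ : ℤ → Carrier
    ⟦ + 1 ⟧ᶜ = 1#
    ⟦ z   ⟧ᶜ = ιℤ R z

    ⟦⟧ᶜ≈ιℤ : ∀ z → ⟦ z ⟧ᶜ ≈ ιℤ R z
    ⟦⟧ᶜ≈ιℤ (+ 0)           = refl
    ⟦⟧ᶜ≈ιℤ (+ 1)           = sym (+-identityʳ 1#)
    ⟦⟧ᶜ≈ιℤ (+ suc (suc n)) = refl
    ⟦⟧ᶜ≈ιℤ -[1+ n ]        = refl

    coefficients : ℤ.+-*-rawRing -Raw-AlmostCommutative⟶ fromCommutativeRing R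
    coefficients = record
      { ⟦_⟧    = ⟦_⟧ᶜ
      ; +-homo = λ i j → trans (⟦⟧ᶜ≈ιℤ (i ℤ.+ j)) (trans (ιℤ-+ i j) (sym (+-cong (⟦⟧ᶜ≈ιℤ i) (⟦⟧ᶜ≈ιℤ j))))
      ; *-homo = λ i j → trans (⟦⟧ᶜ≈ιℤ (i ℤ.* j)) (trans (ιℤ-* i j) (sym (*-cong (⟦⟧ᶜ≈ιℤ i) (⟦⟧ᶜ≈ιℤ j))))
      ; -‿homo = λ i → trans (⟦⟧ᶜ≈ιℤ (ℤ.- i)) (trans (ιℤ-neg i) (-‿cong (sym (⟦⟧ᶜ≈ιℤ i))))
      ; 0-homo = refl
      ; 1-homo = refl
      }

    _≟ᶜ_ : ∀ i j → Maybe (⟦ i ⟧ᶜ ≈ ⟦ j ⟧ᶜ)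
    i ≟ᶜ j with i ℤ.≟ j
    ... | yes ≡.refl = just refl
    ... | no _       = nothing

  open Algebra.Solver.Ring ℤ.+-*-rawRing (fromCommutativeRing R) coefficients _≟ᶜ_
    using (solve; _:+_; _:*_; _:-_; :-_; _:=_; con)

  x[yz]≈y[xz] : ∀ x y z → x * (y * z) ≈ y * (x * z)
  x[yz]≈y[xz] = solve 3 (λ x y z → x :* (y :* z) := y :* (x :* z)) refl

  ιℕ[b+d]-ιℕd≈ιℕb : ∀ {a} b d → a ≡ b ℕ.+ d → ιℕ a - ιℕ d ≈ ιℕ b
  ιℕ[b+d]-ιℕd≈ιℕb {a} b d a≡b+d = trans (+-congʳ (trans (reflexive (cong ιℕ a≡b+d)) (×-homo-+ 1# b d))) (cancel (ιℕ b) (ιℕ d))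
    where
    cancel : ∀ x y → (x + y) - y ≈ x
    cancel = solve 2 (λ x y → (x :+ y) :- y := x) refl

  ιℕa-ιℕ[a+b]≈-ιℕb : ∀ a b {d} → a ℕ.+ b ≡ d → ιℕ a - ιℕ d ≈ - ιℕ b
  ιℕa-ιℕ[a+b]≈-ιℕb a b a+b≡d =
    trans (+-congˡ (-‿cong (trans (reflexive (cong ιℕ (≡.sym a+b≡d))) (×-homo-+ 1# a b)))) (cancel (ιℕ a) (ιℕ b))
    where
    cancel : ∀ x y → x - (x + y) ≈ - y
    cancel = solve 2 (λ x y → x :- (x :+ y) := :- y) refl

  -- Finite sums

  ∑ : ∀ {a} {A : Set a} → List A → (A → Carrier) → Carrier
  ∑ xs f = ringSum R (map f xs)

  ∑-cong : ∀ {a} {A : Set a} (xs : List A) {f g : A → Carrier} → (∀ x → f x ≈ g x) → ∑ xs f ≈ ∑ xs g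
  ∑-cong []       f≈g = refl
  ∑-cong (x ∷ xs) f≈g = +-cong (f≈g x) (∑-cong xs f≈g)

  ∑-zero : ∀ {a} {A : Set a} (xs : List A) {f : A → Carrier} → (∀ x → f x ≈ 0#) → ∑ xs f ≈ 0#
  ∑-zero []       f≈0 = refl
  ∑-zero (x ∷ xs) f≈0 = trans (+-cong (f≈0 x) (∑-zero xs f≈0)) (+-identityʳ 0#)

  ∑-+ : ∀ {a} {A : Set a} (xs : List A) (f g : A → Carrier) → ∑ xs (λ x → f x + g x) ≈ ∑ xs f + ∑ xs g
  ∑-+ []       f g = sym (+-identityʳ 0#)
  ∑-+ (x ∷ xs) f g = trans (+-congˡ (∑-+ xs f g)) (interchange (f x) (g x) (∑ xs f) (∑ xs g))
    where
    interchange : ∀ a b c d → (a + b) + (c + d) ≈ (a + c) + (b + d)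
    interchange = solve 4 (λ a b c d → (a :+ b) :+ (c :+ d) := (a :+ c) :+ (b :+ d)) refl

  *-distribˡ-∑ : ∀ {a} {A : Set a} (xs : List A) (c : Carrier) (f : A → Carrier) → c * ∑ xs f ≈ ∑ xs (λ x → c * f x)
  *-distribˡ-∑ []       c f = zeroʳ c
  *-distribˡ-∑ (x ∷ xs) c f = trans (distribˡ c (f x) (∑ xs f)) (+-congˡ (*-distribˡ-∑ xs c f))

  *-distribʳ-∑ : ∀ {a} {A : Set a} (xs : List A) (c : Carrier) (f : A → Carrier) → ∑ xs f * c ≈ ∑ xs (λ x → f x * c)
  *-distribʳ-∑ xs c f = trans (*-comm _ c) (trans (*-distribˡ-∑ xs c f) (∑-cong xs (λ x → *-comm c (f x))))

  ∑-++ : ∀ {a} {A : Set a} (xs ys : List A) (f : A → Carrier) → ∑ (xs ++ ys) f ≈ ∑ xs f + ∑ ys f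
  ∑-++ []       ys f = sym (+-identityˡ _)
  ∑-++ (x ∷ xs) ys f = trans (+-congˡ (∑-++ xs ys f)) (sym (+-assoc _ _ _))

  ∑-map : ∀ {a b} {A : Set a} {B : Set b} (g : A → B) (xs : List A) (f : B → Carrier) → ∑ (map g xs) f ≈ ∑ xs (λ x → f (g x))
  ∑-map g []       f = refl
  ∑-map g (x ∷ xs) f = +-congˡ (∑-map g xs f)

  ∑-concatMap : ∀ {a b} {A : Set a} {B : Set b} (h : A → List B) (xs : List A) (f : B → Carrier) →
                ∑ (concatMap h xs) f ≈ ∑ xs (λ x → ∑ (h x) f)
  ∑-concatMap h []       f = refl
  ∑-concatMap h (x ∷ xs) f = trans (∑-++ (h x) (concatMap h xs) f) (+-congˡ (∑-concatMap h xs f))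

  ∑-comm : ∀ {a b} {A : Set a} {B : Set b} (xs : List A) (ys : List B) (g : A → B → Carrier) →
           ∑ xs (λ x → ∑ ys (g x)) ≈ ∑ ys (λ y → ∑ xs (λ x → g x y))
  ∑-comm []       ys g = sym (∑-zero ys (λ _ → refl))
  ∑-comm (x ∷ xs) ys g = trans (+-congˡ (∑-comm xs ys g)) (sym (∑-+ ys (g x) _))

  if-yes : ∀ {p} {P : Set p} (P? : Dec P) {x y : Carrier} → P → (if does P? then x else y) ≈ x
  if-yes P? p = reflexive (cong (if_then _ else _) (dec-true P? p))

  if-no : ∀ {p} {P : Set p} (P? : Dec P) {x y : Carrier} → ¬ P → (if does P? then x else y) ≈ y
  if-no P? ¬p = reflexive (cong (if_then _ else _) (dec-false P? ¬p))

  ∑-if : ∀ {a} {A : Set a} (xs : List A) b (f : A → Carrier) → ∑ xs (λ x → if b then f x else 0#) ≈ (if b then ∑ xs f else 0#)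
  ∑-if xs true  f = refl
  ∑-if xs false f = ∑-zero xs (λ _ → refl)

  ∑< : ℕ → (ℕ → Carrier) → Carrier
  ∑< n = ∑ (upTo n)

  ∑<-suc : ∀ n f → ∑< (suc n) f ≈ ∑< n f + f n
  ∑<-suc n f = begin
    ∑ (upTo (suc n)) f          ≡⟨ cong (λ l → ∑ l f) (ListP.upTo-∷ʳ n) ⟨
    ∑ (upTo n ++ n ∷ []) f      ≈⟨ ∑-++ (upTo n) (n ∷ []) f ⟩
    ∑< n f + (f n + 0#)         ≈⟨ +-congˡ (+-identityʳ (f n)) ⟩
    ∑< n f + f n                ∎

  ∑<-cong : ∀ n {f g} → (∀ i → i ℕ.< n → f i ≈ g i) → ∑< n f ≈ ∑< n g
  ∑<-cong zero    f≈g = refl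
  ∑<-cong (suc n) {f} {g} f≈g = begin
    ∑< (suc n) f  ≈⟨ ∑<-suc n f ⟩
    ∑< n f + f n  ≈⟨ +-cong (∑<-cong n (λ i i<n → f≈g i (ℕP.m<n⇒m<1+n i<n))) (f≈g n ℕP.≤-refl) ⟩
    ∑< n g + g n  ≈⟨ ∑<-suc n g ⟨
    ∑< (suc n) g  ∎

  ∑<-const : ∀ n x → ∑< n (λ _ → x) ≈ n × x
  ∑<-const zero    x = refl
  ∑<-const (suc n) x = trans (∑<-suc n _) (trans (+-congʳ (∑<-const n x)) (+-comm _ _))

  ∑<-none : ∀ {p} {P : ℕ → Set p} (P? : ∀ j → Dec (P j)) (g : ℕ → Carrier) {M} →
            (∀ {j} → j ℕ.< M → ¬ P j) → ∑< M (λ j → if does (P? j) then g j else 0#) ≈ 0#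
  ∑<-none P? g {M} ¬P = trans (∑<-cong M (λ j j<M → if-no (P? j) (¬P j<M))) (∑-zero (upTo M) (λ _ → refl))

  ∑<-select : ∀ {p} {P : ℕ → Set p} (P? : ∀ j → Dec (P j)) (g : ℕ → Carrier) {M j₀} →
              j₀ ℕ.< M → P j₀ → (∀ {j} → j ℕ.< M → P j → j ≡ j₀) → ∑< M (λ j → if does (P? j) then g j else 0#) ≈ g j₀
  ∑<-select {P = P} P? g {suc M} {j₀} j₀<1+M Pj₀ unique with ℕP.m≤n⇒m<n∨m≡n (ℕP.≤-pred j₀<1+M)
  ... | inj₁ j₀<M = begin
    ∑< (suc M) f         ≈⟨ ∑<-suc M f ⟩
    ∑< M f + f M         ≈⟨ +-cong (∑<-select P? g j₀<M Pj₀ (λ j<M → unique (ℕP.m<n⇒m<1+n j<M))) (if-no (P? M) M≢j₀) ⟩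
    g j₀ + 0#            ≈⟨ +-identityʳ (g j₀) ⟩
    g j₀                 ∎
    where
    f = λ j → if does (P? j) then g j else 0#
    M≢j₀ : ¬ P M
    M≢j₀ PM = ℕP.<⇒≢ j₀<M (≡.sym (unique ℕP.≤-refl PM))
  ... | inj₂ ≡.refl = begin
    ∑< (suc M) f         ≈⟨ ∑<-suc M f ⟩
    ∑< M f + f M         ≈⟨ +-cong (∑<-none P? g (λ j<M Pj → ℕP.<⇒≢ j<M (unique (ℕP.m<n⇒m<1+n j<M) Pj))) (if-yes (P? M) Pj₀) ⟩
    0# + g M             ≈⟨ +-identityˡ (g M) ⟩
    g M                  ∎
    where
    f = λ j → if does (P? j) then g j else 0#

  ∑tuples : ∀ {k} → Vec ℕ k → (Vec ℕ k → Carrier) → Carrier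
  ∑tuples n = ∑ (tuples n)

  ∑tuples-∷ : ∀ {k} n (ns : Vec ℕ k) F → ∑tuples (n ∷ ns) F ≈ ∑< n (λ i → ∑tuples ns (λ vs → F (suc i ∷ vs)))
  ∑tuples-∷ n ns F = begin
    ∑ (concatMap (λ i → map (i ∷_) (tuples ns)) (map suc (upTo n))) F
      ≈⟨ ∑-concatMap (λ i → map (i ∷_) (tuples ns)) (map suc (upTo n)) F ⟩
    ∑ (map suc (upTo n)) (λ i → ∑ (map (i ∷_) (tuples ns)) F)
      ≈⟨ ∑-map suc (upTo n) _ ⟩
    ∑< n (λ i → ∑ (map (suc i ∷_) (tuples ns)) F)
      ≈⟨ ∑-cong (upTo n) (λ i → ∑-map (suc i ∷_) (tuples ns) F) ⟩
    ∑< n (λ i → ∑tuples ns (λ vs → F (suc i ∷ vs))) ∎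

  ∑tuples-cong : ∀ {k} (n : Vec ℕ k) {F G} → (∀ ms → Pointwise ℕ._≤_ ms n → F ms ≈ G ms) → ∑tuples n F ≈ ∑tuples n G
  ∑tuples-cong []       F≈G = +-congʳ (F≈G [] [])
  ∑tuples-cong (n ∷ ns) {F} {G} F≈G = begin
    ∑tuples (n ∷ ns) F                              ≈⟨ ∑tuples-∷ n ns F ⟩
    ∑< n (λ i → ∑tuples ns (λ vs → F (suc i ∷ vs))) ≈⟨ ∑<-cong n (λ i i<n → ∑tuples-cong ns (λ vs vs≤ns → F≈G (suc i ∷ vs) (i<n ∷ vs≤ns))) ⟩
    ∑< n (λ i → ∑tuples ns (λ vs → G (suc i ∷ vs))) ≈⟨ ∑tuples-∷ n ns G ⟨
    ∑tuples (n ∷ ns) G                              ∎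

  ∑tuples-top : ∀ {k} (n : Vec ℕ k) → AllPositive n → (φ : Vec ℕ k → Carrier) →
                ∑tuples n (λ ms → if does (scaledSumℕ n ms ℕ.≟ k ℕ.* prodℕ n) then φ ms else 0#) ≈ φ n
  ∑tuples-top []       _              φ = +-identityʳ (φ [])
  ∑tuples-top {suc k} (suc n′ ∷ ns) (n>0 , ns>0) φ = begin
    ∑tuples (n ∷ ns) F                                              ≈⟨ ∑tuples-∷ n ns F ⟩
    ∑< n (λ i → ∑tuples ns (λ vs → F (suc i ∷ vs)))                  ≈⟨ ∑<-cong n (λ i i<n → trans (∑tuples-cong ns (split i<n))
                                                                                                   (∑-if (tuples ns) (does (suc i ℕ.≟ n)) _)) ⟩
    ∑< n (λ i → if does (suc i ℕ.≟ n) then g i else 0#)              ≈⟨ ∑<-select (λ i → suc i ℕ.≟ n) g ℕP.≤-refl ≡.refl (λ _ → ℕP.suc-injective) ⟩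
    g n′                                                            ≈⟨ ∑tuples-top ns ns>0 (λ vs → φ (n ∷ vs)) ⟩
    φ (n ∷ ns)                                                      ∎
    where
    n = suc n′
    P = prodℕ ns
    F : Vec ℕ (suc k) → Carrier
    F ms = if does (scaledSumℕ (n ∷ ns) ms ℕ.≟ suc k ℕ.* prodℕ (n ∷ ns)) then φ ms else 0#
    g : ℕ → Carrier
    g i = ∑tuples ns (λ vs → if does (scaledSumℕ ns vs ℕ.≟ k ℕ.* P) then φ (suc i ∷ vs) else 0#)
    expand : ∀ n P k → suc k ℕ.* (n ℕ.* P) ≡ n ℕ.* P ℕ.+ n ℕ.* (k ℕ.* P)
    expand = solve-∀
    max : ∀ {i vs} → i ℕ.< n → Pointwise ℕ._≤_ vs ns →
          suc i ℕ.* P ℕ.+ n ℕ.* scaledSumℕ ns vs ≡ suc k ℕ.* (n ℕ.* P) → suc i ≡ n ×′ scaledSumℕ ns vs ≡ k ℕ.* P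
    max {vs = vs} i<n vs≤ns eq =
      scaledSumℕ-∷≡max i<n (scaledSumℕ≤k*prodℕ ns vs vs≤ns) (prodℕ-pos ns ns>0) n>0 (≡.trans eq (expand n P k))
    split : ∀ {i} → i ℕ.< n → ∀ vs → Pointwise ℕ._≤_ vs ns →
            F (suc i ∷ vs) ≈ (if does (suc i ℕ.≟ n) then (if does (scaledSumℕ ns vs ℕ.≟ k ℕ.* P) then φ (suc i ∷ vs) else 0#) else 0#)
    split {i} i<n vs vs≤ns = by-cases (suc i ℕ.≟ n) (S ℕ.≟ k ℕ.* P)
      where
      S = scaledSumℕ ns vs
      top? = suc i ℕ.* P ℕ.+ n ℕ.* S ℕ.≟ suc k ℕ.* (n ℕ.* P)
      by-cases : Dec (suc i ≡ n) → Dec (S ≡ k ℕ.* P) →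
                 F (suc i ∷ vs) ≈ (if does (suc i ℕ.≟ n) then (if does (S ℕ.≟ k ℕ.* P) then φ (suc i ∷ vs) else 0#) else 0#)
      by-cases (yes 1+i≡n) (yes S≡kP) =
        trans (if-yes top? (≡.trans (cong₂ (λ v S → v ℕ.* P ℕ.+ n ℕ.* S) 1+i≡n S≡kP) (≡.sym (expand n P k))))
              (sym (trans (if-yes (suc i ℕ.≟ n) 1+i≡n) (if-yes (S ℕ.≟ k ℕ.* P) S≡kP)))
      by-cases (yes 1+i≡n) (no S≢kP) =
        trans (if-no top? (λ eq → S≢kP (proj₂ (max i<n vs≤ns eq))))
              (sym (trans (if-yes (suc i ℕ.≟ n) 1+i≡n) (if-no (S ℕ.≟ k ℕ.* P) S≢kP)))
      by-cases (no 1+i≢n) _ =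
        trans (if-no top? (λ eq → 1+i≢n (proj₁ (max i<n vs≤ns eq)))) (sym (if-no (suc i ℕ.≟ n) 1+i≢n))

  -- Finite differences

  -- Degree < d, expressed by the vanishing of all d-fold finite differences (with arbitrary steps);
  -- in particular degree < 0 means identically zero.
  DegreeBelow : ℕ → (ℕ → Carrier) → Set ℓ
  DegreeBelow zero    f = ∀ x → f x ≈ 0#
  DegreeBelow (suc d) f = ∀ h → DegreeBelow d (λ x → f (x ℕ.+ h) - f x)

  DegreeBelow-cong : ∀ d {f g : ℕ → Carrier} → (∀ x → f x ≈ g x) → DegreeBelow d f → DegreeBelow d g
  DegreeBelow-cong zero    f≈g Df x = trans (sym (f≈g x)) (Df x)
  DegreeBelow-cong (suc d) f≈g Df h = DegreeBelow-cong d (λ x → +-cong (f≈g _) (-‿cong (f≈g x))) (Df h)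

  DegreeBelow-∘affine : ∀ d {f} c n → DegreeBelow d f → DegreeBelow d (λ y → f (c ℕ.+ n ℕ.* y))
  DegreeBelow-∘affine zero    c n Df y = Df _
  DegreeBelow-∘affine (suc d) {f} c n Df h =
    DegreeBelow-cong d (λ y → +-congʳ (reflexive (cong f (shift y)))) (DegreeBelow-∘affine d c n (Df (n ℕ.* h)))
    where
    shift : ∀ y → c ℕ.+ n ℕ.* y ℕ.+ n ℕ.* h ≡ c ℕ.+ n ℕ.* (y ℕ.+ h)
    shift y = ≡.trans (ℕP.+-assoc c (n ℕ.* y) (n ℕ.* h)) (cong (c ℕ.+_) (≡.sym (ℕP.*-distribˡ-+ n y h)))

  DegreeBelow-+ : ∀ d {f g} → DegreeBelow d f → DegreeBelow d g → DegreeBelow d (λ x → f x + g x)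
  DegreeBelow-+ zero    Df Dg x = trans (+-cong (Df x) (Dg x)) (+-identityʳ 0#)
  DegreeBelow-+ (suc d) Df Dg h = DegreeBelow-cong d (λ x → interchange _ _ _ _) (DegreeBelow-+ d (Df h) (Dg h))
    where
    interchange : ∀ a b c e → (a - b) + (c - e) ≈ (a + c) - (b + e)
    interchange = solve 4 (λ a b c e → (a :- b) :+ (c :- e) := (a :+ c) :- (b :+ e)) refl

  DegreeBelow-*ˡ : ∀ d {f} c → DegreeBelow d f → DegreeBelow d (λ x → c * f x)
  DegreeBelow-*ˡ zero    c Df x = trans (*-congˡ (Df x)) (zeroʳ c)
  DegreeBelow-*ˡ (suc d) c Df h = DegreeBelow-cong d (λ x → distrib-- c _ _) (DegreeBelow-*ˡ d c (Df h))
    where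
    distrib-- : ∀ c a b → c * (a - b) ≈ c * a - c * b
    distrib-- = solve 3 (λ c a b → c :* (a :- b) := c :* a :- c :* b) refl

  -- The product rule  Δₕ(f·(c − x)) = Δₕf·((c − h) − x) − h·f.
  DegreeBelow-*linear : ∀ d {f} c → DegreeBelow d f → DegreeBelow (suc d) (λ x → f x * (c - ιℕ x))
  DegreeBelow-*linear zero    {f} c Df h x = begin
    f (x ℕ.+ h) * (c - ιℕ (x ℕ.+ h)) - f x * (c - ιℕ x) ≈⟨ +-cong (*-congʳ (Df _)) (-‿cong (*-congʳ (Df x))) ⟩
    0# * (c - ιℕ (x ℕ.+ h)) - 0# * (c - ιℕ x)           ≈⟨ +-cong (zeroˡ _) (-‿cong (zeroˡ _)) ⟩
    0# - 0#                                             ≈⟨ -‿inverseʳ 0# ⟩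
    0#                                                  ∎
  DegreeBelow-*linear (suc d) {f} c Df h =
    DegreeBelow-cong (suc d) (λ x → sym (product-rule x))
      (DegreeBelow-+ (suc d) (DegreeBelow-*linear d (c - ιℕ h) (Df h)) (DegreeBelow-*ˡ (suc d) (- ιℕ h) Df))
    where
    expand : ∀ a b c x h → a * (c - (x + h)) - b * (c - x) ≈ (a - b) * ((c - h) - x) + (- h) * b
    expand = solve 5 (λ a b c x h → a :* (c :- (x :+ h)) :- b :* (c :- x) := (a :- b) :* ((c :- h) :- x) :+ (:- h) :* b) refl
    product-rule : ∀ x → f (x ℕ.+ h) * (c - ιℕ (x ℕ.+ h)) - f x * (c - ιℕ x)
                         ≈ (f (x ℕ.+ h) - f x) * ((c - ιℕ h) - ιℕ x) + (- ιℕ h) * f x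
    product-rule x = trans (+-congʳ (*-congˡ (+-congˡ (-‿cong (×-homo-+ 1# x h))))) (expand _ _ _ _ _)

  ∑-shift-invariant : ∀ {a} {A : Set a} (xs : List A) (S : A → ℕ) (χ : A → Carrier) d {f} b n →
    (∀ {g} → DegreeBelow d g → ∑ xs (λ x → g (S x) * χ x) ≈ 0#) →
    DegreeBelow (suc d) f → ∑ xs (λ x → f (b ℕ.+ n ℕ.* S x) * χ x) ≈ ∑ xs (λ x → f (n ℕ.* S x) * χ x)
  ∑-shift-invariant xs S χ d {f} b n annihilates Df = begin
    ∑ xs (λ x → f (b ℕ.+ n ℕ.* S x) * χ x)                 ≈⟨ ∑-cong xs (λ x → *-congʳ (split x)) ⟩
    ∑ xs (λ x → (f (n ℕ.* S x) + Δ (S x)) * χ x)           ≈⟨ ∑-cong xs (λ x → distribʳ (χ x) _ _) ⟩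
    ∑ xs (λ x → f (n ℕ.* S x) * χ x + Δ (S x) * χ x)       ≈⟨ ∑-+ xs _ _ ⟩
    ∑ xs (λ x → f (n ℕ.* S x) * χ x) + ∑ xs (λ x → Δ (S x) * χ x)
                                                            ≈⟨ +-congˡ (annihilates (DegreeBelow-∘affine d 0 n (Df b))) ⟩
    ∑ xs (λ x → f (n ℕ.* S x) * χ x) + 0#                  ≈⟨ +-identityʳ _ ⟩
    ∑ xs (λ x → f (n ℕ.* S x) * χ x)                       ∎
    where
    Δ : ℕ → Carrier
    Δ y = f (n ℕ.* y ℕ.+ b) - f (n ℕ.* y)
    x≈y+[x-y] : ∀ x y → x ≈ y + (x - y)
    x≈y+[x-y] = solve 2 (λ x y → x := y :+ (x :- y)) refl
    split : ∀ x → f (b ℕ.+ n ℕ.* S x) ≈ f (n ℕ.* S x) + Δ (S x)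
    split x = trans (reflexive (cong f (ℕP.+-comm b (n ℕ.* S x)))) (x≈y+[x-y] _ _)

  nodeProduct : ℕ → ℕ → ℕ → ℕ → Carrier
  nodeProduct m N zero    x = 1#
  nodeProduct m N (suc i) x = nodeProduct m N i x * (ιℕ ((m ℕ.+ suc i) ℕ.* N) - ιℕ x)

  nodeProduct-degree : ∀ m N i → DegreeBelow (suc i) (nodeProduct m N i)
  nodeProduct-degree m N zero    h x = -‿inverseʳ 1#
  nodeProduct-degree m N (suc i)     = DegreeBelow-*linear (suc i) _ (nodeProduct-degree m N i)

  nodeProduct-below : ∀ m N i {j} → j ℕ.≤ m → nodeProduct m N i (j ℕ.* N) ≈ ιℕ (N ℕ.^ i ℕ.* rising (m ℕ.∸ j) i)
  nodeProduct-below m N zero    j≤m = sym (+-identityʳ 1#)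
  nodeProduct-below m N (suc i) {j} j≤m = begin
    nodeProduct m N i (j ℕ.* N) * (ιℕ ((m ℕ.+ suc i) ℕ.* N) - ιℕ (j ℕ.* N))
      ≈⟨ *-cong (nodeProduct-below m N i j≤m) (ιℕ[b+d]-ιℕd≈ιℕb ((y ℕ.+ suc i) ℕ.* N) (j ℕ.* N) factor) ⟩
    ιℕ (N ℕ.^ i ℕ.* rising y i) * ιℕ ((y ℕ.+ suc i) ℕ.* N)
      ≈⟨ ×1-homo-* (N ℕ.^ i ℕ.* rising y i) ((y ℕ.+ suc i) ℕ.* N) ⟨
    ιℕ (N ℕ.^ i ℕ.* rising y i ℕ.* ((y ℕ.+ suc i) ℕ.* N))
      ≡⟨ cong ιℕ (rearrange (N ℕ.^ i) (rising y i) (y ℕ.+ suc i) N) ⟩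
    ιℕ (N ℕ.^ suc i ℕ.* rising y (suc i)) ∎
    where
    y = m ℕ.∸ j
    rearrange : ∀ P r c N → P ℕ.* r ℕ.* (c ℕ.* N) ≡ N ℕ.* P ℕ.* (r ℕ.* c)
    rearrange = solve-∀
    distribute : ∀ y j i N → (y ℕ.+ j ℕ.+ suc i) ℕ.* N ≡ (y ℕ.+ suc i) ℕ.* N ℕ.+ j ℕ.* N
    distribute = solve-∀
    factor : (m ℕ.+ suc i) ℕ.* N ≡ (y ℕ.+ suc i) ℕ.* N ℕ.+ j ℕ.* N
    factor = ≡.trans (cong (λ t → (t ℕ.+ suc i) ℕ.* N) (≡.sym (ℕP.m∸n+n≡m j≤m))) (distribute y j i N)

  nodeProduct-node : ∀ m N i {t} → 1 ℕ.≤ t → t ℕ.≤ i → nodeProduct m N i ((m ℕ.+ t) ℕ.* N) ≈ 0#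
  nodeProduct-node m N zero    (ℕ.s≤s _) ()
  nodeProduct-node m N (suc i) {t} 1≤t t≤1+i with ℕP.m≤n⇒m<n∨m≡n t≤1+i
  ... | inj₁ t<1+i  = trans (*-congʳ (nodeProduct-node m N i 1≤t (ℕP.≤-pred t<1+i))) (zeroˡ _)
  ... | inj₂ ≡.refl = trans (*-congˡ (-‿inverseʳ _)) (zeroʳ _)

  nodeProduct-top : ∀ m N q i → i ℕ.≤ q → nodeProduct m N i ((m ℕ.+ suc q) ℕ.* N) ≈ (- 1#) ^ i * ιℕ (N ℕ.^ i ℕ.* (q P′ i))
  nodeProduct-top m N q zero    _     = sym (trans (*-identityˡ _) (+-identityʳ 1#))
  nodeProduct-top m N q (suc i) i<q = begin
    nodeProduct m N i ((m ℕ.+ suc q) ℕ.* N) * (ιℕ ((m ℕ.+ suc i) ℕ.* N) - ιℕ ((m ℕ.+ suc q) ℕ.* N))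
      ≈⟨ *-cong (nodeProduct-top m N q i (ℕP.<⇒≤ i<q)) (ιℕa-ιℕ[a+b]≈-ιℕb ((m ℕ.+ suc i) ℕ.* N) ((q ℕ.∸ i) ℕ.* N) factor) ⟩
    ((- 1#) ^ i * ιℕ (N ℕ.^ i ℕ.* (q P′ i))) * (- ιℕ ((q ℕ.∸ i) ℕ.* N))
      ≈⟨ sign ((- 1#) ^ i) _ _ ⟩
    (- 1# * (- 1#) ^ i) * (ιℕ (N ℕ.^ i ℕ.* (q P′ i)) * ιℕ ((q ℕ.∸ i) ℕ.* N))
      ≈⟨ *-congˡ (×1-homo-* (N ℕ.^ i ℕ.* (q P′ i)) ((q ℕ.∸ i) ℕ.* N)) ⟨
    (- 1#) ^ suc i * ιℕ (N ℕ.^ i ℕ.* (q P′ i) ℕ.* ((q ℕ.∸ i) ℕ.* N))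
      ≡⟨ cong (λ t → (- 1#) ^ suc i * ιℕ t) (rearrange (N ℕ.^ i) (q P′ i) (q ℕ.∸ i) N) ⟩
    (- 1#) ^ suc i * ιℕ (N ℕ.^ suc i ℕ.* (q P′ suc i)) ∎
    where
    sign : ∀ s x y → (s * x) * (- y) ≈ (- 1# * s) * (x * y)
    sign = solve 3 (λ s x y → (s :* x) :* (:- y) := (:- con 1ℤ :* s) :* (x :* y)) refl
    rearrange : ∀ P p d N → P ℕ.* p ℕ.* (d ℕ.* N) ≡ N ℕ.* P ℕ.* (d ℕ.* p)
    rearrange = solve-∀
    factor : (m ℕ.+ suc i) ℕ.* N ℕ.+ (q ℕ.∸ i) ℕ.* N ≡ (m ℕ.+ suc q) ℕ.* N
    factor = ≡.trans (≡.sym (ℕP.*-distribʳ-+ N (m ℕ.+ suc i) (q ℕ.∸ i)))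
               (cong (ℕ._* N) (≡.trans (ℕP.+-assoc m (suc i) (q ℕ.∸ i)) (cong (λ t → m ℕ.+ suc t) (ℕP.m+[n∸m]≡n (ℕP.<⇒≤ i<q)))))

  -- Roots of unity and characters

  1^n≈1 : ∀ n → 1# ^ n ≈ 1#
  1^n≈1 zero    = refl
  1^n≈1 (suc n) = trans (*-identityˡ _) (1^n≈1 n)

  ^[q*N]≈1 : ∀ {w N} q → w ^ N ≈ 1# → w ^ (q ℕ.* N) ≈ 1#
  ^[q*N]≈1 {w} {N} q wᴺ≈1 = begin
    w ^ (q ℕ.* N)  ≡⟨ cong (w ^_) (ℕP.*-comm q N) ⟩
    w ^ (N ℕ.* q)  ≈⟨ ^-assocʳ w N q ⟨
    (w ^ N) ^ q    ≈⟨ ^-congˡ q wᴺ≈1 ⟩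
    1# ^ q         ≈⟨ 1^n≈1 q ⟩
    1#             ∎

  ^≈1-if-∣ : ∀ {w N x} → w ^ N ≈ 1# → N ∣ x → w ^ x ≈ 1#
  ^≈1-if-∣ {w} wᴺ≈1 (divides q ≡.refl) = ^[q*N]≈1 q wᴺ≈1

  ^[u+q*N]≈^u : ∀ {w N} u q → w ^ N ≈ 1# → w ^ (u ℕ.+ q ℕ.* N) ≈ w ^ u
  ^[u+q*N]≈^u {w} {N} u q wᴺ≈1 = trans (^-homo-* w u (q ℕ.* N)) (trans (*-congˡ (^[q*N]≈1 q wᴺ≈1)) (*-identityʳ _))

  ^≉1-if-∤ : ∀ {w N x} → .{{_ : ℕ.NonZero N}} → IsPrimitiveRoot R N w → ¬ N ∣ x → ¬ w ^ x ≈ 1#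
  ^≉1-if-∤ {w} {N} {x} prim N∤x wˣ≈1 with x ℕ.% N in x%N≡r
  ... | zero  = N∤x (ℕD.m%n≡0⇒n∣m x N x%N≡r)
  ... | suc r = IsPrimitiveRoot.isPrimitive prim (suc r) (ℕ.s≤s ℕ.z≤n) (≡.subst (ℕ._< N) x%N≡r (ℕDM.m%n<n x N)) (begin
    w ^ suc r                         ≡⟨ cong (w ^_) x%N≡r ⟨
    w ^ (x ℕ.% N)                     ≈⟨ ^[u+q*N]≈^u (x ℕ.% N) (x ℕ./ N) (IsPrimitiveRoot.root prim) ⟨
    w ^ (x ℕ.% N ℕ.+ x ℕ./ N ℕ.* N)   ≡⟨ cong (w ^_) (ℕDM.m≡m%n+[m/n]*n x N) ⟨
    w ^ x                             ≈⟨ wˣ≈1 ⟩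
    1#                                ∎)

  IsPrimitiveRoot-^ : ∀ {w} n P → .{{_ : ℕ.NonZero n}} → IsPrimitiveRoot R (n ℕ.* P) w → IsPrimitiveRoot R P (w ^ n)
  IsPrimitiveRoot-^ {w} n P prim = record
    { root        = trans (^-assocʳ w n P) (IsPrimitiveRoot.root prim)
    ; isPrimitive = λ d d>0 d<P wⁿᵈ≈1 → IsPrimitiveRoot.isPrimitive prim (n ℕ.* d)
        (ℕP.*-mono-< (ℕ.>-nonZero⁻¹ n) d>0) (ℕP.*-monoʳ-< n d<P) (trans (sym (^-assocʳ w n d)) wⁿᵈ≈1)
    }

  geometric-sum : ∀ ξ s n → (ξ - 1#) * ∑< n (λ i → ξ ^ (s ℕ.+ i)) ≈ ξ ^ (s ℕ.+ n) - ξ ^ s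
  geometric-sum ξ s zero = begin
    (ξ - 1#) * 0#            ≈⟨ zeroʳ _ ⟩
    0#                       ≈⟨ -‿inverseʳ _ ⟨
    ξ ^ s - ξ ^ s            ≡⟨ cong (λ t → ξ ^ t - ξ ^ s) (ℕP.+-identityʳ s) ⟨
    ξ ^ (s ℕ.+ 0) - ξ ^ s    ∎
  geometric-sum ξ s (suc n) = begin
    (ξ - 1#) * ∑< (suc n) (λ i → ξ ^ (s ℕ.+ i))                        ≈⟨ *-congˡ (∑<-suc n _) ⟩
    (ξ - 1#) * (∑< n (λ i → ξ ^ (s ℕ.+ i)) + ξ ^ (s ℕ.+ n))             ≈⟨ distribˡ _ _ _ ⟩
    (ξ - 1#) * ∑< n (λ i → ξ ^ (s ℕ.+ i)) + (ξ - 1#) * ξ ^ (s ℕ.+ n)    ≈⟨ +-congʳ (geometric-sum ξ s n) ⟩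
    (ξ ^ (s ℕ.+ n) - ξ ^ s) + (ξ - 1#) * ξ ^ (s ℕ.+ n)                 ≈⟨ telescope ξ (ξ ^ (s ℕ.+ n)) (ξ ^ s) ⟩
    ξ * ξ ^ (s ℕ.+ n) - ξ ^ s                                          ≡⟨ cong (λ t → ξ ^ t - ξ ^ s) (ℕP.+-suc s n) ⟨
    ξ ^ (s ℕ.+ suc n) - ξ ^ s                                          ∎
    where
    telescope : ∀ ξ a b → (a - b) + (ξ - 1#) * a ≈ ξ * a - b
    telescope = solve 3 (λ ξ a b → (a :- b) :+ (ξ :- con 1ℤ) :* a := ξ :* a :- b) refl

  ^-cong-modℤ : ∀ {w N} r u Z → w ^ N ≈ 1# → + r ≡ + u ℤ.+ Z ℤ.* + N → w ^ r ≈ w ^ u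
  ^-cong-modℤ {w} {N} r u (+ z) wᴺ≈1 eq =
    trans (^-congʳ w (ℤP.+-injective (≡.trans eq (≡.sym (+[u+q*N]≡+u++q*+N u z N))))) (^[u+q*N]≈^u u z wᴺ≈1)
  ^-cong-modℤ {w} {N} r u -[1+ z ] wᴺ≈1 eq =
    sym (trans (^-congʳ w (ℤP.+-injective (≡.trans (cancel (+ u) (+ suc z) (+ N))
                                          (≡.trans (cong (ℤ._+ + suc z ℤ.* + N) (≡.sym eq)) (≡.sym (+[u+q*N]≡+u++q*+N r (suc z) N))))))
               (^[u+q*N]≈^u r (suc z) wᴺ≈1))
    where
    cancel : ∀ u s N → u ≡ (u ℤ.+ ℤ.- s ℤ.* N) ℤ.+ s ℤ.* N
    cancel = solveℤ-∀

  powℤ≈^ : ∀ {w N} .{{_ : ℕ.NonZero N}} z u Y → w ^ N ≈ 1# → z ≡ + u ℤ.+ Y ℤ.* + N → powℤ R N w z ≈ w ^ u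
  powℤ≈^ (+ e) u Y wᴺ≈1 eq = ^-cong-modℤ e u Y wᴺ≈1 eq
  powℤ≈^ {w} {suc N′} -[1+ e ] u Y wᴺ≈1 eq =
    trans (^-assocʳ w N′ (suc e)) (^-cong-modℤ {N = suc N′} (N′ ℕ.* suc e) u (Y ℤ.+ + suc e) wᴺ≈1 (N′[1+e]≡-[1+e]-mod {u} {Y} N′ e eq))

  ^-scaledDot-∷ : ∀ {k} w n (ns cs vs : Vec ℕ k) c v →
    w ^ scaledDot (n ∷ ns) (c ∷ cs) (v ∷ vs) ≈ (w ^ (c ℕ.* prodℕ ns)) ^ v * (w ^ n) ^ scaledDot ns cs vs
  ^-scaledDot-∷ w n ns cs vs c v = begin
    w ^ (c ℕ.* v ℕ.* P ℕ.+ n ℕ.* X)        ≈⟨ ^-homo-* w (c ℕ.* v ℕ.* P) (n ℕ.* X) ⟩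
    w ^ (c ℕ.* v ℕ.* P) * w ^ (n ℕ.* X)    ≡⟨ cong (λ e → w ^ e * w ^ (n ℕ.* X)) (swap c v P) ⟩
    w ^ (c ℕ.* P ℕ.* v) * w ^ (n ℕ.* X)    ≈⟨ *-cong (^-assocʳ w (c ℕ.* P) v) (^-assocʳ w n X) ⟨
    (w ^ (c ℕ.* P)) ^ v * (w ^ n) ^ X      ∎
    where
    P = prodℕ ns
    X = scaledDot ns cs vs
    swap : ∀ c v P → c ℕ.* v ℕ.* P ≡ c ℕ.* P ℕ.* v
    swap = solve-∀

  ∑tuples-character-∷ : ∀ {k} n (ns cs : Vec ℕ k) c w (g : ℕ → Carrier) →
    ∑tuples (n ∷ ns) (λ ms → g (scaledSumℕ (n ∷ ns) ms) * w ^ scaledDot (n ∷ ns) (c ∷ cs) ms)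
      ≈ ∑< n (λ i → (w ^ (c ℕ.* prodℕ ns)) ^ suc i
                    * ∑tuples ns (λ vs → g (suc i ℕ.* prodℕ ns ℕ.+ n ℕ.* scaledSumℕ ns vs) * (w ^ n) ^ scaledDot ns cs vs))
  ∑tuples-character-∷ n ns cs c w g = trans (∑tuples-∷ n ns _) (∑-cong (upTo n) λ i → begin
    ∑tuples ns (λ vs → g (a i vs) * w ^ scaledDot (n ∷ ns) (c ∷ cs) (suc i ∷ vs))
      ≈⟨ ∑-cong (tuples ns) (λ vs → *-congˡ (^-scaledDot-∷ w n ns cs vs c (suc i))) ⟩
    ∑tuples ns (λ vs → g (a i vs) * (ξ ^ suc i * (w ^ n) ^ scaledDot ns cs vs))
      ≈⟨ ∑-cong (tuples ns) (λ vs → x[yz]≈y[xz] (g (a i vs)) (ξ ^ suc i) _) ⟩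
    ∑tuples ns (λ vs → ξ ^ suc i * (g (a i vs) * (w ^ n) ^ scaledDot ns cs vs))
      ≈⟨ *-distribˡ-∑ (tuples ns) (ξ ^ suc i) _ ⟨
    ξ ^ suc i * ∑tuples ns (λ vs → g (a i vs) * (w ^ n) ^ scaledDot ns cs vs) ∎)
    where
    ξ = w ^ (c ℕ.* prodℕ ns)
    a : ℕ → Vec ℕ _ → ℕ
    a i vs = suc i ℕ.* prodℕ ns ℕ.+ n ℕ.* scaledSumℕ ns vs

  module _ (dom : IsChar0Domain R) where
    open IsChar0Domain dom

    *-cancelˡ-≈0 : ∀ {a x} → ¬ a ≈ 0# → a * x ≈ 0# → x ≈ 0#
    *-cancelˡ-≈0 {a} {x} a≉0 ax≈0 with noZeroDivisors a x ax≈0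
    ... | inj₁ a≈0 = contradiction a≈0 a≉0
    ... | inj₂ x≈0 = x≈0

    *-cancelˡ : ∀ {a x y} → ¬ a ≈ 0# → a * x ≈ a * y → x ≈ y
    *-cancelˡ {a} {x} {y} a≉0 ax≈ay = x∙y⁻¹≈ε⇒x≈y x y (*-cancelˡ-≈0 a≉0 (begin
      a * (x - y)       ≈⟨ distribˡ a x (- y) ⟩
      a * x + a * - y   ≈⟨ +-cong ax≈ay (sym (-‿distribʳ-* a y)) ⟩
      a * y - a * y     ≈⟨ -‿inverseʳ (a * y) ⟩
      0#                ∎))

    ιℕ≉0 : ∀ K → .{{_ : ℕ.NonZero K}} → ¬ ιℕ K ≈ 0#
    ιℕ≉0 (suc K) = char0 K

    ∑-geometric≈0 : ∀ {ξ n} s → ξ ^ n ≈ 1# → ¬ ξ ≈ 1# → ∑< n (λ i → ξ ^ (s ℕ.+ i)) ≈ 0#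
    ∑-geometric≈0 {ξ} {n} s ξⁿ≈1 ξ≉1 = *-cancelˡ-≈0 ξ-1≉0 (begin
      (ξ - 1#) * ∑< n (λ i → ξ ^ (s ℕ.+ i)) ≈⟨ geometric-sum ξ s n ⟩
      ξ ^ (s ℕ.+ n) - ξ ^ s                  ≈⟨ +-congʳ (^-homo-* ξ s n) ⟩
      ξ ^ s * ξ ^ n - ξ ^ s                  ≈⟨ +-congʳ (trans (*-congˡ ξⁿ≈1) (*-identityʳ _)) ⟩
      ξ ^ s - ξ ^ s                          ≈⟨ -‿inverseʳ _ ⟩
      0#                                     ∎)
      where
      ξ-1≉0 : ¬ ξ - 1# ≈ 0#
      ξ-1≉0 ξ-1≈0 = ξ≉1 (x∙y⁻¹≈ε⇒x≈y ξ 1# ξ-1≈0)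

    -- A coordinate with n_s ∣ c_s only changes the argument of f affinely; one with n_s ∤ c_s leaves a
    -- vanishing geometric sum once the finite difference in that coordinate is split off.
    ∑tuples-poly*character≈0 : ∀ {k} (n c : Vec ℕ k) {w} → AllPositive n → IsPrimitiveRoot R (prodℕ n) w →
      ∀ d {f} → DegreeBelow d f → d ℕ.≤ nondivisible n c →
      ∑tuples n (λ ms → f (scaledSumℕ n ms) * w ^ scaledDot n c ms) ≈ 0#
    ∑tuples-poly*character≈0 n c pos prim zero Df _ = ∑-zero (tuples n) (λ ms → trans (*-congʳ (Df _)) (zeroˡ _))
    ∑tuples-poly*character≈0 [] [] _ _ (suc d) _ ()
    ∑tuples-poly*character≈0 (n ∷ ns) (c ∷ cs) {w} (n>0 , ns>0) prim (suc d) {f} Df d<  with n ∣? c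
    ... | yes n∣c = trans (∑tuples-character-∷ n ns cs c w f) (∑-zero (upTo n) λ i →
      trans (*-congˡ (∑tuples-poly*character≈0 ns cs ns>0 prim′ (suc d) (DegreeBelow-∘affine (suc d) (suc i ℕ.* P) n Df) d<))
            (zeroʳ _))
      where
      P = prodℕ ns
      instance _ = ℕ.>-nonZero n>0
      prim′ = IsPrimitiveRoot-^ n P prim
    ... | no n∤c = begin
      ∑tuples (n ∷ ns) (λ ms → f (scaledSumℕ (n ∷ ns) ms) * w ^ scaledDot (n ∷ ns) (c ∷ cs) ms)
        ≈⟨ ∑tuples-character-∷ n ns cs c w f ⟩
      ∑< n (λ i → ξ ^ suc i * ∑tuples ns (λ vs → f (suc i ℕ.* P ℕ.+ n ℕ.* scaledSumℕ ns vs) * χ vs))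
        ≈⟨ ∑-cong (upTo n) (λ i → *-congˡ (∑-shift-invariant (tuples ns) (scaledSumℕ ns) χ d (suc i ℕ.* P) n
                                              (λ Dg → ∑tuples-poly*character≈0 ns cs ns>0 prim′ d Dg (ℕP.≤-pred d<)) Df)) ⟩
      ∑< n (λ i → ξ ^ (1 ℕ.+ i) * A)
        ≈⟨ *-distribʳ-∑ (upTo n) A _ ⟨
      ∑< n (λ i → ξ ^ (1 ℕ.+ i)) * A
        ≈⟨ *-congʳ (∑-geometric≈0 {n = n} 1 ξⁿ≈1 ξ≉1) ⟩
      0# * A
        ≈⟨ zeroˡ A ⟩
      0# ∎
      where
      P = prodℕ ns
      instance _ = ℕ.>-nonZero n>0
      instance _ = ℕ.>-nonZero (prodℕ-pos ns ns>0)
      instance _ = ℕ.>-nonZero (prodℕ-pos (n ∷ ns) (n>0 , ns>0))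
      prim′ = IsPrimitiveRoot-^ n P prim
      ξ = w ^ (c ℕ.* P)
      χ : Vec ℕ _ → Carrier
      χ vs = (w ^ n) ^ scaledDot ns cs vs
      A = ∑tuples ns (λ vs → f (n ℕ.* scaledSumℕ ns vs) * χ vs)
      ξⁿ≈1 : ξ ^ n ≈ 1#
      ξⁿ≈1 = trans (^-assocʳ w (c ℕ.* P) n) (^≈1-if-∣ (IsPrimitiveRoot.root prim) (divides c (rearrange c P n)))
        where
        rearrange : ∀ c P n → c ℕ.* P ℕ.* n ≡ c ℕ.* (n ℕ.* P)
        rearrange = solve-∀
      ξ≉1 : ¬ ξ ≈ 1#
      ξ≉1 = ^≉1-if-∤ prim (λ nP∣cP → n∤c (ℕD.*-cancelʳ-∣ P nP∣cP))

    orthogonality : ∀ {ω N} .{{_ : ℕ.NonZero N}} → IsPrimitiveRoot R N ω → ∀ x y →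
                    ιℕ N * (if does (N ∣? x) then y else 0#) ≈ ∑< N (λ ρ → (ω ^ x) ^ ρ) * y
    orthogonality {ω} {N} prim x y with N ∣? x
    ... | yes N∣x = *-congʳ (sym (trans (∑<-cong N (λ ρ _ → trans (^-congˡ ρ (^≈1-if-∣ root N∣x)) (1^n≈1 ρ))) (∑<-const N 1#)))
      where root = IsPrimitiveRoot.root prim
    ... | no N∤x = begin
      ιℕ N * 0#                          ≈⟨ zeroʳ _ ⟩
      0#                                 ≈⟨ zeroˡ y ⟨
      0# * y                             ≈⟨ *-congʳ (∑-geometric≈0 {n = N} 0 ξᴺ≈1 (^≉1-if-∤ prim N∤x)) ⟨
      ∑< N (λ ρ → (ω ^ x) ^ ρ) * y       ∎
      where
      ξᴺ≈1 : (ω ^ x) ^ N ≈ 1#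
      ξᴺ≈1 = trans (^-assocʳ ω x N) (^[q*N]≈1 x (IsPrimitiveRoot.root prim))

    module _ {k} (m : ℕ) (a : Vec ℤ k) (n : Vec ℕ k) (pos : AllPositive n) {ω} (prim : IsPrimitiveRoot R (prodℕ n) ω) where
      private
        N = prodℕ n
        instance _ = ℕ.>-nonZero (prodℕ-pos n pos)
        root = IsPrimitiveRoot.root prim
        Ŝ = scaledSumℕ n
        ā = Vec.map (ℤ._%ℕ N) a

      χ : Vec ℕ k → Carrier
      χ ms = powℤ R N ω (scaledSumℤ n (mulVec a ms))

      χ≈ω^scaledDot : ∀ ms → χ ms ≈ ω ^ scaledDot n ā ms
      χ≈ω^scaledDot ms = powℤ≈^ _ (scaledDot n ā ms) (scaledSumℤ n (mulVec (Vec.map (ℤ._/ℕ N) a) ms)) root (scaledSumℤ-mod N n a ms)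

      χ-top : Vec ℕ k → Carrier
      χ-top ms = if does (Ŝ ms ℕ.≟ k ℕ.* N) then χ ms else 0#

      ∑tuples-χ-top≈1 : ∑tuples n χ-top ≈ 1#
      ∑tuples-χ-top≈1 = trans (∑tuples-top n pos χ)
        (trans (χ≈ω^scaledDot n) (^≈1-if-∣ root (divides (Vec.sum ā) (scaledDot-top n ā))))

      ∑tuples-divisible*poly*χ≈0 : IsMSystem m a n → ∀ d {G} → DegreeBelow d G → d ℕ.+ m ℕ.≤ k →
        ∑tuples n (λ ms → if does (N ∣? Ŝ ms) then G (Ŝ ms) * χ ms else 0#) ≈ 0#
      ∑tuples-divisible*poly*χ≈0 msys d {G} DG d+m≤k = *-cancelˡ-≈0 (ιℕ≉0 N) (begin
        ιℕ N * ∑tuples n (λ ms → if does (N ∣? Ŝ ms) then G (Ŝ ms) * χ ms else 0#)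
          ≈⟨ *-distribˡ-∑ (tuples n) _ _ ⟩
        ∑tuples n (λ ms → ιℕ N * (if does (N ∣? Ŝ ms) then G (Ŝ ms) * χ ms else 0#))
          ≈⟨ ∑-cong (tuples n) (λ ms → orthogonality prim (Ŝ ms) _) ⟩
        ∑tuples n (λ ms → ∑< N (λ ρ → (ω ^ Ŝ ms) ^ ρ) * (G (Ŝ ms) * χ ms))
          ≈⟨ ∑-cong (tuples n) (λ ms → *-distribʳ-∑ (upTo N) _ _) ⟩
        ∑tuples n (λ ms → ∑< N (λ ρ → (ω ^ Ŝ ms) ^ ρ * (G (Ŝ ms) * χ ms)))
          ≈⟨ ∑-cong (tuples n) (λ ms → ∑<-cong N (λ ρ _ → trans (x[yz]≈y[xz] _ _ _) (*-congˡ (shift ρ ms)))) ⟩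
        ∑tuples n (λ ms → ∑< N (λ ρ → G (Ŝ ms) * ω ^ scaledDot n (cρ ρ) ms))
          ≈⟨ ∑-comm (tuples n) (upTo N) _ ⟩
        ∑< N (λ ρ → ∑tuples n (λ ms → G (Ŝ ms) * ω ^ scaledDot n (cρ ρ) ms))
          ≈⟨ ∑-zero (upTo N) (λ ρ → ∑tuples-poly*character≈0 n (cρ ρ) pos prim d DG (d≤nondivisible ρ)) ⟩
        0# ∎)
        where
        cρ : ℕ → Vec ℕ k
        cρ ρ = Vec.map (λ z → ρ ℕ.+ z ℤ.%ℕ N) a
        shift : ∀ ρ ms → (ω ^ Ŝ ms) ^ ρ * χ ms ≈ ω ^ scaledDot n (cρ ρ) ms
        shift ρ ms = begin
          (ω ^ Ŝ ms) ^ ρ * χ ms                          ≈⟨ *-cong (^-assocʳ ω (Ŝ ms) ρ) (χ≈ω^scaledDot ms) ⟩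
          ω ^ (Ŝ ms ℕ.* ρ) * ω ^ scaledDot n ā ms         ≈⟨ ^-homo-* ω (Ŝ ms ℕ.* ρ) _ ⟨
          ω ^ (Ŝ ms ℕ.* ρ ℕ.+ scaledDot n ā ms)           ≡⟨ cong (ω ^_) (scaledDot-shift (ℤ._%ℕ N) ρ n a ms) ⟨
          ω ^ scaledDot n (cρ ρ) ms                        ∎
        d≤nondivisible : ∀ ρ → d ℕ.≤ nondivisible n (cρ ρ)
        d≤nondivisible ρ = ℕP.+-cancelʳ-≤ m d _ (ℕP.≤-trans d+m≤k (ℕP.≤-trans (k≤nondivisible+coverCount N ρ n a (∣prodℕ n))
                             (ℕP.+-monoʳ-≤ (nondivisible n (cρ ρ)) (msys (ℤ.- + ρ)))))

      -- corollaryLHS R m k a n ω is  ∑tuples n term  by definition.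
      term : Vec ℕ k → Carrier
      term ms = sumUpTo R m (λ j → if does (j ℕ.* N ℕ.≟ Ŝ ms)
                                     then ιℤ R (gbinom (+ k ℤ.- + 1 ℤ.- + j) (m ℕ.∸ j)) * χ ms else 0#)

      term-at : ∀ ms {j} → Ŝ ms ≡ j ℕ.* N → j ℕ.≤ m → term ms ≈ ιℤ R (gbinom (+ k ℤ.- + 1 ℤ.- + j) (m ℕ.∸ j)) * χ ms
      term-at ms Ŝ≡jN j≤m =
        ∑<-select (λ j → j ℕ.* N ℕ.≟ Ŝ ms) _ (ℕ.s≤s j≤m) (≡.sym Ŝ≡jN) (λ _ eq → ℕP.*-cancelʳ-≡ _ _ N (≡.trans eq Ŝ≡jN))

      term-vanishes : ∀ ms → (∀ {j} → j ℕ.≤ m → ¬ j ℕ.* N ≡ Ŝ ms) → term ms ≈ 0#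
      term-vanishes ms ne = ∑<-none (λ j → j ℕ.* N ℕ.≟ Ŝ ms) _ (λ j<1+m → ne (ℕP.≤-pred j<1+m))

      data ScaledSumView (ms : Vec ℕ k) : Set where
        off   : ¬ N ∣ Ŝ ms → ScaledSumView ms
        below : ∀ j → j ℕ.< k → Ŝ ms ≡ j ℕ.* N → ScaledSumView ms
        top   : Ŝ ms ≡ k ℕ.* N → ScaledSumView ms

      scaledSumView : ∀ ms → Pointwise ℕ._≤_ ms n → ScaledSumView ms
      scaledSumView ms ms≤n with N ∣? Ŝ ms
      ... | no N∤Ŝ = off N∤Ŝ
      ... | yes (divides j Ŝ≡jN)
        with ℕP.m≤n⇒m<n∨m≡n (ℕP.*-cancelʳ-≤ j k N (≡.subst (ℕ._≤ k ℕ.* N) Ŝ≡jN (scaledSumℕ≤k*prodℕ n ms ms≤n)))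
      ...   | inj₁ j<k    = below j j<k Ŝ≡jN
      ...   | inj₂ ≡.refl = top Ŝ≡jN

      off-top : ∀ {ms} → ¬ N ∣ Ŝ ms → ¬ Ŝ ms ≡ k ℕ.* N
      off-top N∤Ŝ Ŝ≡kN = N∤Ŝ (divides k Ŝ≡kN)

      below-top : ∀ {ms j} → j ℕ.< k → Ŝ ms ≡ j ℕ.* N → ¬ Ŝ ms ≡ k ℕ.* N
      below-top j<k Ŝ≡jN Ŝ≡kN = ℕP.<⇒≢ j<k (ℕP.*-cancelʳ-≡ _ _ N (≡.trans (≡.sym Ŝ≡jN) Ŝ≡kN))

      above-m : ∀ {ms j} → m ℕ.< j → Ŝ ms ≡ j ℕ.* N → ∀ {j′} → j′ ℕ.≤ m → ¬ j′ ℕ.* N ≡ Ŝ ms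
      above-m m<j Ŝ≡jN j′≤m eq = ℕP.<⇒≢ (ℕP.≤-<-trans j′≤m m<j) (ℕP.*-cancelʳ-≡ _ _ N (≡.trans eq Ŝ≡jN))

      off-term : ∀ {ms} → ¬ N ∣ Ŝ ms → term ms ≈ 0#
      off-term {ms} N∤Ŝ = term-vanishes ms (λ {j} _ eq → N∤Ŝ (divides j (≡.sym eq)))

      module _ (k≤m : k ℕ.≤ m) where
        private
          sign = (- 1#) ^ (m ℕ.∸ k)

        term≈sign*χ-top : ∀ ms → Pointwise ℕ._≤_ ms n → term ms ≈ sign * χ-top ms
        term≈sign*χ-top ms ms≤n with scaledSumView ms ms≤n
        ... | off N∤Ŝ = trans (off-term N∤Ŝ) (sym (trans (*-congˡ (if-no (_ ℕ.≟ _) (off-top N∤Ŝ))) (zeroʳ sign)))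
        ... | below j j<k Ŝ≡jN = begin
          term ms                                                ≈⟨ term-at ms Ŝ≡jN (ℕP.<⇒≤ (ℕP.<-≤-trans j<k k≤m)) ⟩
          ιℤ R (gbinom (+ k ℤ.- + 1 ℤ.- + j) (m ℕ.∸ j)) * χ ms   ≡⟨ cong (λ z → ιℤ R z * χ ms) binom≡0 ⟩
          0# * χ ms                                              ≈⟨ zeroˡ (χ ms) ⟩
          0#                                                     ≈⟨ zeroʳ sign ⟨
          sign * 0#                                              ≈⟨ *-congˡ (if-no (_ ℕ.≟ _) (below-top j<k Ŝ≡jN)) ⟨
          sign * χ-top ms                                        ∎
          where
          k∸1∸j<m∸j : k ℕ.∸ 1 ℕ.∸ j ℕ.< m ℕ.∸ j
          k∸1∸j<m∸j = ℕP.<-≤-trans (ℕP.≤-reflexive (≡.trans (cong suc (ℕP.∸-+-assoc k 1 j)) (≡.sym (ℕP.+-∸-assoc 1 j<k))))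
                                   (ℕP.∸-monoˡ-≤ j k≤m)
          binom≡0 : gbinom (+ k ℤ.- + 1 ℤ.- + j) (m ℕ.∸ j) ≡ + 0
          binom≡0 = ≡.trans (cong (λ z → gbinom z (m ℕ.∸ j)) (+k-+1-+j≡+[k∸1∸j] j<k))
                            (≡.trans (gbinom-pos (k ℕ.∸ 1 ℕ.∸ j) (m ℕ.∸ j)) (cong +_ (ℕC.k>n⇒nCk≡0 k∸1∸j<m∸j)))
        ... | top Ŝ≡kN = begin
          term ms                                                ≈⟨ term-at ms Ŝ≡kN k≤m ⟩
          ιℤ R (gbinom (+ k ℤ.- + 1 ℤ.- + k) (m ℕ.∸ k)) * χ ms   ≡⟨ cong (λ z → ιℤ R (gbinom z (m ℕ.∸ k)) * χ ms) (+k-+1-+k≡-1 k) ⟩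
          ιℤ R (gbinom -1ℤ (m ℕ.∸ k)) * χ ms                     ≡⟨ cong (λ z → ιℤ R z * χ ms) (gbinom-[-1] (m ℕ.∸ k)) ⟩
          ιℤ R (-1ℤ ℤ.^ (m ℕ.∸ k)) * χ ms                        ≈⟨ *-congʳ (ιℤ-[-1]^ (m ℕ.∸ k)) ⟩
          sign * χ ms                                            ≈⟨ *-congˡ (if-yes (_ ℕ.≟ _) Ŝ≡kN) ⟨
          sign * χ-top ms                                        ∎

        corollary-k≤m : corollaryLHS R m k a n ω ≈ signPow R (+ k ℤ.- + m)
        corollary-k≤m = begin
          ∑tuples n term                         ≈⟨ ∑tuples-cong n term≈sign*χ-top ⟩
          ∑tuples n (λ ms → sign * χ-top ms)     ≈⟨ *-distribˡ-∑ (tuples n) sign χ-top ⟨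
          sign * ∑tuples n χ-top                 ≈⟨ *-congˡ ∑tuples-χ-top≈1 ⟩
          sign * 1#                              ≈⟨ *-identityʳ sign ⟩
          sign                                   ≡⟨ cong ((- 1#) ^_) (≡.trans (cong ℤ.∣_∣ (ℤP.m-n≡m⊖n k m)) (ℤP.∣⊖∣-≤ k≤m)) ⟨
          signPow R (+ k ℤ.- + m)                ∎

      module _ (q : ℕ) (k≡m+1+q : k ≡ m ℕ.+ suc q) where
        private
          K = N ℕ.^ q ℕ.* q !
          instance _ = ℕ.>-nonZero (ℕP.*-mono-< (ℕP.m^n>0 N q) (ℕP.1≤n! q))
          G = nodeProduct m N q
          C = - G (k ℕ.* N)
          m<k : m ℕ.< k
          m<k = ℕP.≤-trans (ℕP.m<m+n m (ℕ.s≤s ℕ.z≤n)) (ℕP.≤-reflexive (≡.sym k≡m+1+q))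
          χ-divisible : Vec ℕ k → Carrier
          χ-divisible ms = if does (N ∣? Ŝ ms) then G (Ŝ ms) * χ ms else 0#

        C≈K*signPow : C ≈ ιℕ K * signPow R (+ k ℤ.- + m)
        C≈K*signPow = begin
          - G (k ℕ.* N)                              ≡⟨ cong (λ t → - G (t ℕ.* N)) k≡m+1+q ⟩
          - G ((m ℕ.+ suc q) ℕ.* N)                  ≈⟨ -‿cong (nodeProduct-top m N q q ℕP.≤-refl) ⟩
          - ((- 1#) ^ q * ιℕ (N ℕ.^ q ℕ.* (q P′ q)))  ≡⟨ cong (λ t → - ((- 1#) ^ q * ιℕ (N ℕ.^ q ℕ.* t))) qP′q≡q! ⟩
          - ((- 1#) ^ q * ιℕ K)                      ≈⟨ negate ((- 1#) ^ q) (ιℕ K) ⟩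
          ιℕ K * (- 1#) ^ suc q                      ≡⟨ cong (λ e → ιℕ K * (- 1#) ^ e) ∣k-m∣≡1+q ⟨
          ιℕ K * signPow R (+ k ℤ.- + m)             ∎
          where
          negate : ∀ s x → - (s * x) ≈ x * (- 1# * s)
          negate = solve 2 (λ s x → :- (s :* x) := x :* (:- con 1ℤ :* s)) refl
          qP′q≡q! : q P′ q ≡ q !
          qP′q≡q! = ≡.trans (≡.sym (nPk≡nP′k (ℕP.≤-refl {q}))) (ℕC.nPn≡n! q)
          ∣k-m∣≡1+q : ℤ.∣ + k ℤ.- + m ∣ ≡ suc q
          ∣k-m∣≡1+q = ≡.trans (cong ℤ.∣_∣ (+m-+n≡+[m∸n] (ℕP.<⇒≤ m<k)))
                              (≡.trans (cong (ℕ._∸ m) k≡m+1+q) (ℕP.m+n∸m≡n m (suc q)))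

        K*binom≈G : ∀ {j} → j ℕ.≤ m → ιℕ K * ιℤ R (gbinom (+ k ℤ.- + 1 ℤ.- + j) (m ℕ.∸ j)) ≈ G (j ℕ.* N)
        K*binom≈G {j} j≤m = begin
          ιℕ K * ιℤ R (gbinom (+ k ℤ.- + 1 ℤ.- + j) y)    ≡⟨ cong (λ z → ιℕ K * ιℤ R (gbinom z y)) k-1-j≡y+q ⟩
          ιℕ K * ιℤ R (gbinom (+ (y ℕ.+ q)) y)             ≡⟨ cong (λ z → ιℕ K * ιℤ R z) (gbinom-pos (y ℕ.+ q) y) ⟩
          ιℕ K * ιℕ ((y ℕ.+ q) ℕC.C y)                     ≈⟨ ×1-homo-* K ((y ℕ.+ q) ℕC.C y) ⟨
          ιℕ (N ℕ.^ q ℕ.* q ! ℕ.* ((y ℕ.+ q) ℕC.C y))      ≡⟨ cong ιℕ (≡.trans (ℕP.*-assoc (N ℕ.^ q) (q !) _) (cong (N ℕ.^ q ℕ.*_) (q!*[y+q]Cy≡rising y q))) ⟩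
          ιℕ (N ℕ.^ q ℕ.* rising y q)                       ≈⟨ nodeProduct-below m N q j≤m ⟨
          G (j ℕ.* N)                                       ∎
          where
          y = m ℕ.∸ j
          k-1-j≡y+q : + k ℤ.- + 1 ℤ.- + j ≡ + (y ℕ.+ q)
          k-1-j≡y+q = ≡.trans (+k-+1-+j≡+[k∸1∸j] (ℕP.≤-<-trans j≤m m<k)) (cong +_
                        (≡.trans (cong (λ t → t ℕ.∸ 1 ℕ.∸ j) (≡.trans k≡m+1+q (ℕP.+-suc m q))) (ℕP.+-∸-comm q j≤m)))

        K*term≈χ-divisible+C*χ-top : ∀ ms → Pointwise ℕ._≤_ ms n → ιℕ K * term ms ≈ χ-divisible ms + C * χ-top ms
        K*term≈χ-divisible+C*χ-top ms ms≤n with scaledSumView ms ms≤n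
        ... | off N∤Ŝ = begin
          ιℕ K * term ms                  ≈⟨ trans (*-congˡ (off-term N∤Ŝ)) (zeroʳ _) ⟩
          0#                              ≈⟨ trans (+-congˡ (zeroʳ C)) (+-identityʳ 0#) ⟨
          0# + C * 0#                     ≈⟨ +-cong (if-no (N ∣? Ŝ ms) N∤Ŝ) (*-congˡ (if-no (_ ℕ.≟ _) (off-top N∤Ŝ))) ⟨
          χ-divisible ms + C * χ-top ms   ∎
        ... | top Ŝ≡kN = begin
          ιℕ K * term ms                  ≈⟨ trans (*-congˡ (term-vanishes ms (above-m m<k Ŝ≡kN))) (zeroʳ _) ⟩
          0#                              ≈⟨ cancel (G (k ℕ.* N)) (χ ms) ⟨
          G (k ℕ.* N) * χ ms + C * χ ms   ≡⟨ cong (λ x → G x * χ ms + C * χ ms) Ŝ≡kN ⟨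
          G (Ŝ ms) * χ ms + C * χ ms      ≈⟨ +-cong (if-yes (N ∣? Ŝ ms) (divides k Ŝ≡kN)) (*-congˡ (if-yes (_ ℕ.≟ _) Ŝ≡kN)) ⟨
          χ-divisible ms + C * χ-top ms   ∎
          where
          cancel : ∀ g x → g * x + (- g) * x ≈ 0#
          cancel = solve 2 (λ g x → g :* x :+ (:- g) :* x := con (+ 0)) refl
        ... | below j j<k Ŝ≡jN = begin
          ιℕ K * term ms                  ≈⟨ K*term≈G*χ ⟩
          G (Ŝ ms) * χ ms                 ≈⟨ trans (+-congˡ (zeroʳ C)) (+-identityʳ _) ⟨
          G (Ŝ ms) * χ ms + C * 0#        ≈⟨ +-cong (if-yes (N ∣? Ŝ ms) (divides j Ŝ≡jN)) (*-congˡ (if-no (_ ℕ.≟ _) (below-top j<k Ŝ≡jN))) ⟨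
          χ-divisible ms + C * χ-top ms   ∎
          where
          K*term≈G*χ : ιℕ K * term ms ≈ G (Ŝ ms) * χ ms
          K*term≈G*χ with j ℕ.≤? m
          ... | yes j≤m = begin
            ιℕ K * term ms                                                ≈⟨ *-congˡ (term-at ms Ŝ≡jN j≤m) ⟩
            ιℕ K * (ιℤ R (gbinom (+ k ℤ.- + 1 ℤ.- + j) (m ℕ.∸ j)) * χ ms) ≈⟨ *-assoc _ _ _ ⟨
            ιℕ K * ιℤ R (gbinom (+ k ℤ.- + 1 ℤ.- + j) (m ℕ.∸ j)) * χ ms   ≈⟨ *-congʳ (K*binom≈G j≤m) ⟩
            G (j ℕ.* N) * χ ms                                            ≡⟨ cong (λ x → G x * χ ms) Ŝ≡jN ⟨
            G (Ŝ ms) * χ ms                                               ∎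
          ... | no j≰m = begin
            ιℕ K * term ms                      ≈⟨ trans (*-congˡ (term-vanishes ms (above-m m<j Ŝ≡jN))) (zeroʳ _) ⟩
            0#                                  ≈⟨ zeroˡ (χ ms) ⟨
            0# * χ ms                           ≈⟨ *-congʳ (nodeProduct-node m N q (ℕP.m<n⇒0<n∸m m<j) j∸m≤q) ⟨
            G ((m ℕ.+ (j ℕ.∸ m)) ℕ.* N) * χ ms  ≡⟨ cong (λ x → G x * χ ms) (≡.trans (cong (ℕ._* N) (ℕP.m+[n∸m]≡n (ℕP.<⇒≤ m<j))) (≡.sym Ŝ≡jN)) ⟩
            G (Ŝ ms) * χ ms                     ∎
            where
            m<j = ℕP.≰⇒> j≰m
            j∸m≤q : j ℕ.∸ m ℕ.≤ q
            j∸m≤q = ℕP.+-cancelˡ-≤ m _ _ (ℕP.≤-trans (ℕP.≤-reflexive (ℕP.m+[n∸m]≡n (ℕP.<⇒≤ m<j)))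
                      (ℕP.≤-pred (ℕP.≤-trans j<k (ℕP.≤-reflexive (≡.trans k≡m+1+q (ℕP.+-suc m q))))))

        corollary-m<k : IsMSystem m a n → corollaryLHS R m k a n ω ≈ signPow R (+ k ℤ.- + m)
        corollary-m<k msys = *-cancelˡ (ιℕ≉0 K) (begin
          ιℕ K * ∑tuples n term                                 ≈⟨ *-distribˡ-∑ (tuples n) (ιℕ K) term ⟩
          ∑tuples n (λ ms → ιℕ K * term ms)                     ≈⟨ ∑tuples-cong n K*term≈χ-divisible+C*χ-top ⟩
          ∑tuples n (λ ms → χ-divisible ms + C * χ-top ms)      ≈⟨ ∑-+ (tuples n) χ-divisible (λ ms → C * χ-top ms) ⟩
          ∑tuples n χ-divisible + ∑tuples n (λ ms → C * χ-top ms)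
                                                                ≈⟨ +-cong ∑χ-divisible≈0 (sym (*-distribˡ-∑ (tuples n) C χ-top)) ⟩
          0# + C * ∑tuples n χ-top                              ≈⟨ +-identityˡ _ ⟩
          C * ∑tuples n χ-top                                   ≈⟨ *-congˡ ∑tuples-χ-top≈1 ⟩
          C * 1#                                                ≈⟨ *-identityʳ C ⟩
          C                                                     ≈⟨ C≈K*signPow ⟩
          ιℕ K * signPow R (+ k ℤ.- + m)                        ∎)
          where
          ∑χ-divisible≈0 : ∑tuples n χ-divisible ≈ 0#
          ∑χ-divisible≈0 = ∑tuples-divisible*poly*χ≈0 msys (suc q) (nodeProduct-degree m N q)
                             (ℕP.≤-reflexive (≡.trans (ℕP.+-comm (suc q) m) (≡.sym k≡m+1+q)))

open import Data.Nat using (_<_)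
open import Data.Integer using (_-_)

corollary3p1 : ∀ {c ℓ} (R : CommutativeRing c ℓ) → IsChar0Domain R →
    (m k : ℕ) → 0 < m → 0 < k → (a : Vec ℤ k) → (n : Vec ℕ k) → AllPositive n →
    IsMSystem m a n →
    (ω : CommutativeRing.Carrier R) → IsPrimitiveRoot R (prodℕ n) ω →
    CommutativeRing._≈_ R (corollaryLHS R m k a n ω) (signPow R (+ k - + m))
corollary3p1 R dom m k _ _ a n pos msys ω prim with k ℕ.≤? m
... | yes k≤m = corollary-k≤m R dom m a n pos prim k≤m
... | no  k≰m = corollary-m<k R dom m a n pos prim (k ℕ.∸ suc m)
                  (≡.sym (≡.trans (ℕP.+-suc m (k ℕ.∸ suc m)) (ℕP.m+[n∸m]≡n (ℕP.≰⇒> k≰m)))) msys
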